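{- Let $\mathbf{PF}=\Bbbk\mathrm{PF}$ be the linearized species of parking functions. Then $\mathbf{PF}$ is a Hopf monoid in species under the product $\mu^{\mathbf{PF}}_{S,T}(\Phi\otimes\Psi)=\Phi|\Psi$ (concatenation) and the coproduct $\Delta^{\mathbf{PF}}_{S,T}(\Phi)=\mathsf{park}(\Phi_{\cap S})\otimes\mathsf{park}(\Phi_{\cap T})$.
   Context: Work over a field $\Bbbk$ of characteristic $0$; Hopf monoids are taken in the braided monoidal category of species (functors from finite sets with bijections to vector spaces) under the Cauchy product $(\mathbf p\cdot\mathbf q)[I]=\bigoplus_{S\sqcup T=I}\mathbf p[S]\otimes\mathbf q[T]$ (ordered decompositions, parts possibly empty), with unit species $\mathbf1$ and trivial braiding. A weak set composition of $I$ is a finite list $\Gamma=(A_1,\dots,A_k)$ of pairwise disjoint, possibly empty subsets with union $I$; its length is $\ell(\Gamma)=k$ and size $|\Gamma|=\sum_i|A_i|$. For $|I|=n$, a parking function on $I$ is a weak set composition $(A_1,\dots,A_n)$ of $I$ of length $n$ with $\sum_{i=1}^k|A_i|\ge k$ for all $1\le k\le n$; $\mathrm{PF}[I]$ is the set of these (with $\mathrm{PF}[\emptyset]=\{()\}$), and bijections act by relabelling. For $S\subseteq I$ and $\Phi=(A_1,\dots,A_n)$, $\Phi_{\cap S}=(A_1\cap S,\dots,A_n\cap S)$. $\Phi|\Psi$ is concatenation of lists. For a weak set composition $\Gamma=(B_1,\dots,B_k)$, $\mathsf{park}(\Gamma)$ is computed as follows: start with $\Phi=()$; for $i=1,\dots,k$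 in order, if $|\Phi|+|B_i|\ge\ell(\Phi)+1$ then append $B_i$ to $\Phi$, otherwise discard $B_i$; return $\Phi$. -}

module Defs where

open import Level using (Level; _⊔_) renaming (suc to lsuc)
open import Data.Nat as ℕ using (ℕ; zero; suc; _≤_; _≡ᵇ_)
open import Data.Bool using (Bool; true; false; if_then_else_)
open import Data.Fin using (Fin)
open import Data.Vec using (Vec; []; _∷_; tabulate; lookup)
import Data.Vec.Properties as VecP
open import Data.Fin.Subset using (Subset; Side; inside; outside; ⊥; _∩_; _∪_; _─_; ∣_∣)
open import Data.Fin.Permutation using (Permutation′; _⟨$⟩ˡ_; _∘ₚ_)
import Data.Fin.Permutation as Perm
open import Data.List using (List; []; _∷_; _++_; length; take; map; concatMap; foldr)
import Data.List.Properties as ListP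
open import Data.Product using (_×_; _,_; proj₁; proj₂; ∃)
open import Relation.Binary.PropositionalEquality using (_≡_)
open import Relation.Binary.Definitions using (DecidableEquality)
open import Relation.Nullary using (¬_; does)
open import Algebra.Bundles using (CommutativeRing)
import Data.Bool.Properties as BoolP

record Field (c ℓ : Level) : Set (lsuc (c ⊔ ℓ)) where
  field
    commutativeRing : CommutativeRing c ℓ
  open CommutativeRing commutativeRing public
  field
    0≉1     : ¬ (0# ≈ 1#)
    inverse : ∀ x → ¬ (x ≈ 0#) → ∃ λ y → (x * y) ≈ 1#

natToField : ∀ {c ℓ} (K : Field c ℓ) → ℕ → Field.Carrier K
natToField K zero    = Field.0# K
natToField K (suc m) = Field._+_ K (Field.1# K) (natToField K m)

CharZero : ∀ {c ℓ} → Field c ℓ → Set ℓ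
CharZero K = ∀ m → Field._≈_ K (natToField K m) (Field.0# K) → m ≡ 0

-- Finite sets are modelled as subsets of an ambient Fin n; bijections
-- are modelled by permutations of the ambient set Fin n.

-- relabelling of a subset along σ : i ∈ σ·A  iff  σ⁻¹ i ∈ A
actS : ∀ {n} → Permutation′ n → Subset n → Subset n
actS σ A = tabulate (λ i → lookup A (σ ⟨$⟩ˡ i))

subsetsOf : ∀ {n} → Subset n → List (Subset n)
subsetsOf []            = [] ∷ []
subsetsOf (outside ∷ I) = map (outside ∷_) (subsetsOf I)
subsetsOf (inside ∷ I)  = map (outside ∷_) (subsetsOf I) ++ map (inside ∷_) (subsetsOf I)

WSC : ℕ → Set
WSC n = List (Subset n)

size : ∀ {n} → WSC n → ℕ
size = foldr (λ A k → ∣ A ∣ ℕ.+ k) 0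

unionW : ∀ {n} → WSC n → Subset n
unionW = foldr _∪_ ⊥

PairwiseDisjoint : ∀ {n} → WSC n → Set
PairwiseDisjoint []      = Data.Unit.⊤ where import Data.Unit
PairwiseDisjoint (A ∷ Φ) = (∀ B → B Data.List.Membership.Propositional.∈ Φ → (A ∩ B) ≡ ⊥) × PairwiseDisjoint Φ
  where import Data.List.Membership.Propositional

IsWSCof : ∀ {n} → Subset n → WSC n → Set
IsWSCof I Γ = PairwiseDisjoint Γ × unionW Γ ≡ I

IsPF : ∀ {n} → Subset n → WSC n → Set
IsPF I Φ = IsWSCof I Φ × length Φ ≡ ∣ I ∣
         × (∀ k → k ≤ length Φ → k ≤ size (take k Φ))

actW : ∀ {n} → Permutation′ n → WSC n → WSC n
actW σ = map (actS σ)

restrict : ∀ {n} → WSC n → Subset n → WSC n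
restrict Φ S = map (_∩ S) Φ

-- park, processing B₁,…,B_k left to right; acc is the current Φ
-- (kept in order), sz = |Φ|, len = ℓ(Φ)
parkAux : ∀ {n} → WSC n → ℕ → ℕ → WSC n → WSC n
parkAux acc sz len []      = acc
parkAux acc sz len (B ∷ Γ) =
  if suc len ℕ.≤ᵇ (sz ℕ.+ ∣ B ∣)
  then parkAux (acc ++ (B ∷ [])) (sz ℕ.+ ∣ B ∣) (suc len) Γ
  else parkAux acc sz len Γ

park : ∀ {n} → WSC n → WSC n
park = parkAux [] 0 0

μPF : ∀ {n} → WSC n → WSC n → WSC n
μPF Φ Ψ = Φ ++ Ψ

ΔPF : ∀ {n} → Subset n → Subset n → WSC n → WSC n × WSC n
ΔPF S T Φ = park (restrict Φ S) , park (restrict Φ T)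

_≟W_ : ∀ {n} → DecidableEquality (WSC n)
_≟W_ = ListP.≡-dec (VecP.≡-dec BoolP._≟_)

-- Hopf monoid structure on the linearization 𝕜X of a set species X
-- whose elements on I are represented by x : E n with X I x, and whose
-- product and coproduct are induced by set maps μ, Δ (on basis elements).
-- The unit is e ∈ X[∅] and the counit sends each basis element of 𝕜X[∅]
-- to 1.  Linear combinations (elements of 𝕜X[I]) are finite formal sums.

module _ {c ℓ} (K : Field c ℓ) {E : ℕ → Set} (_≟E_ : ∀ {n} → DecidableEquality (E n)) where
  open Field K

  LC : ℕ → Set c
  LC n = List (Carrier × E n)

  coeff : ∀ {n} → LC n → E n → Carrier
  coeff []            w = 0#
  coeff ((a , v) ∷ l) w = (if does (v ≟E w) then a else 0#) + coeff l w

  _≈LC_ : ∀ {n} → LC n → LC n → Set ℓ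
  l ≈LC l' = ∀ w → coeff l w ≈ coeff l' w

  record IsHopfMonoid
      (X   : ∀ {n} → Subset n → E n → Set)
      (act : ∀ {n} → Permutation′ n → E n → E n)
      (μ   : ∀ {n} → E n → E n → E n)
      (Δ   : ∀ {n} → Subset n → Subset n → E n → E n × E n)
      (e   : ∀ {n} → E n)
      : Set (c ⊔ ℓ) where
    field
      act-X    : ∀ {n} (σ : Permutation′ n) {I x} → X I x → X (actS σ I) (act σ x)
      act-id   : ∀ {n} (x : E n) → act Perm.id x ≡ x
      act-∘    : ∀ {n} (π ρ : Permutation′ n) (x : E n) → act (π ∘ₚ ρ) x ≡ act ρ (act π x)
      μ-X      : ∀ {n} {S T : Subset n} {x y} → (S ∩ T) ≡ ⊥ →
                 X S x → X T y → X (S ∪ T) (μ x y)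
      Δ-X      : ∀ {n} {S T : Subset n} {x} → (S ∩ T) ≡ ⊥ → X (S ∪ T) x →
                 X S (proj₁ (Δ S T x)) × X T (proj₂ (Δ S T x))
      μ-nat    : ∀ {n} (σ : Permutation′ n) {S T : Subset n} {x y} → (S ∩ T) ≡ ⊥ →
                 X S x → X T y → act σ (μ x y) ≡ μ (act σ x) (act σ y)
      Δ-nat    : ∀ {n} (σ : Permutation′ n) {S T : Subset n} {x} → (S ∩ T) ≡ ⊥ →
                 X (S ∪ T) x →
                 Δ (actS σ S) (actS σ T) (act σ x)
                   ≡ (act σ (proj₁ (Δ S T x)) , act σ (proj₂ (Δ S T x)))
      e-X      : ∀ {n} → X {n} ⊥ e
      μ-assoc  : ∀ {n} {R S T : Subset n} {x y z} →
                 (R ∩ S) ≡ ⊥ → (R ∩ T) ≡ ⊥ → (S ∩ T) ≡ ⊥ →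
                 X R x → X S y → X T z → μ (μ x y) z ≡ μ x (μ y z)
      μ-unitˡ  : ∀ {n} {I : Subset n} {x} → X I x → μ e x ≡ x
      μ-unitʳ  : ∀ {n} {I : Subset n} {x} → X I x → μ x e ≡ x
      Δ-coassoc : ∀ {n} {R S T : Subset n} {x} →
                 (R ∩ S) ≡ ⊥ → (R ∩ T) ≡ ⊥ → (S ∩ T) ≡ ⊥ → X (R ∪ S ∪ T) x →
                 (Δ R S (proj₁ (Δ (R ∪ S) T x)) , proj₂ (Δ (R ∪ S) T x))
                   ≡ ((proj₁ (Δ R (S ∪ T) x) , proj₁ (Δ S T (proj₂ (Δ R (S ∪ T) x))))
                     , proj₂ (Δ S T (proj₂ (Δ R (S ∪ T) x))))
      Δ-counitˡ : ∀ {n} {I : Subset n} {x} → X I x → Δ ⊥ I x ≡ (e , x)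
      Δ-counitʳ : ∀ {n} {I : Subset n} {x} → X I x → Δ I ⊥ x ≡ (x , e)
      compat   : ∀ {n} {S T S' T' : Subset n} {x y} →
                 (S ∩ T) ≡ ⊥ → (S' ∩ T') ≡ ⊥ → (S ∪ T) ≡ (S' ∪ T') →
                 X S x → X T y →
                 Δ S' T' (μ x y)
                   ≡ ( μ (proj₁ (Δ (S ∩ S') (S ∩ T') x)) (proj₁ (Δ (T ∩ S') (T ∩ T') y))
                     , μ (proj₂ (Δ (S ∩ S') (S ∩ T') x)) (proj₂ (Δ (T ∩ S') (T ∩ T') y)))
      s        : ∀ {n} → Subset n → E n → LC n
      s-X      : ∀ {n} {I : Subset n} {x} w → X I x → ¬ (coeff (s I x) w ≈ 0#) → X I w
      s-nat    : ∀ {n} (σ : Permutation′ n) {I : Subset n} {x} w → X I x →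
                 coeff (s (actS σ I) (act σ x)) (act σ w) ≈ coeff (s I x) w
      -- Σ_{S ⊔ T = I} μ_{S,T}(id ⊗ s_T)Δ_{S,T} = ι ε  and symmetrically
      s-left   : ∀ {n} {I : Subset n} {x} → X I x →
                 concatMap (λ S → map (λ { (a , w) → (a , μ (proj₁ (Δ S (I ─ S) x)) w) })
                                      (s (I ─ S) (proj₂ (Δ S (I ─ S) x))))
                           (subsetsOf I)
                   ≈LC (if ∣ I ∣ ≡ᵇ 0 then (1# , e) ∷ [] else [])
      s-right  : ∀ {n} {I : Subset n} {x} → X I x →
                 concatMap (λ S → map (λ { (a , w) → (a , μ w (proj₂ (Δ S (I ─ S) x))) })
                                      (s S (proj₁ (Δ S (I ─ S) x))))
                           (subsetsOf I)
                   ≈LC (if ∣ I ∣ ≡ᵇ 0 then (1# , e) ∷ [] else [])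

{-# OPTIONS --safe #-}

-- Parking scans the blocks once and keeps a block iff the surplus |Φ| − ℓ(Φ) of what
-- has been kept stays nonnegative. Restriction shrinks blocks and so can only lower the
-- surplus at every step: parking after a restriction drops everything an earlier park
-- dropped, whence park(park(Φ∩V)∩W) = park(Φ∩V∩W) (coassociativity), and a parking
-- function, whose surplus ends at 0, still ends at 0 after restriction, so parking
-- (Φ|Ψ)∩V restarts from surplus 0 on Ψ (compatibility with concatenation).
-- The antipode is Takeuchi's recursion, a left convolution inverse by construction and a
-- right inverse by expanding Σ s_S · Φ↾T · s_R over decompositions S ⊔ T ⊔ R = I in two
-- ways, by induction on |I|.
module Submission where

open import Defs
open import Data.List using ([])
open import Algebra.Bundles using (CommutativeRing)


module Subsets where

  open import Data.Nat using (ℕ; suc; _+_; _<_; z≤n; s≤s)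
  import Data.Nat.Properties as ℕ
  open import Data.Vec using ([]; _∷_; here)
  import Data.Vec as Vec
  import Data.Vec.Properties as Vec
  open import Data.Bool.Properties using (∧-zeroʳ; ∧-idem; ∧-identityʳ)
  open import Data.Fin.Subset using (Subset; inside; outside; ⊥; _∩_; _∪_; _─_; ∁; ∣_∣; _⊆_)
  open import Data.Fin.Subset.Properties using (drop-∷-⊆; out⊆; s⊆s; ⊆-refl)
  open import Data.List using ([]; _∷_; _++_; map)
  open import Data.List.Membership.Propositional using () renaming (_∈_ to _∈ˡ_)
  open import Data.List.Membership.Propositional.Properties using (∈-map⁺; ∈-map⁻; ∈-++⁺ˡ; ∈-++⁺ʳ; ∈-++⁻)
  open import Data.List.Relation.Unary.Any using () renaming (here to hereˡ)
  open import Data.List.Relation.Unary.Unique.Propositional using (Unique)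
  import Data.List.Relation.Unary.Unique.Propositional.Properties as Unique
  open import Data.List.Relation.Unary.AllPairs using ([]; _∷_)
  open import Data.List.Relation.Unary.All using ([])
  open import Data.Product using (_×_; _,_)
  open import Data.Sum using (inj₁; inj₂)
  open import Relation.Nullary using (¬_; contradiction)
  open import Relation.Binary.PropositionalEquality

  private variable
    n : ℕ
    p q : Subset n

  ∣p∣≡0⇒p≡⊥ : (p : Subset n) → ∣ p ∣ ≡ 0 → p ≡ ⊥
  ∣p∣≡0⇒p≡⊥ []            _  = refl
  ∣p∣≡0⇒p≡⊥ (outside ∷ p) eq = cong (outside ∷_) (∣p∣≡0⇒p≡⊥ p eq)

  ∣p∪q∣≡∣p∣+∣q∣ : (p q : Subset n) → p ∩ q ≡ ⊥ → ∣ p ∪ q ∣ ≡ ∣ p ∣ + ∣ q ∣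
  ∣p∪q∣≡∣p∣+∣q∣ []            []            _  = refl
  ∣p∪q∣≡∣p∣+∣q∣ (inside  ∷ p) (outside ∷ q) eq = cong suc (∣p∪q∣≡∣p∣+∣q∣ p q (cong Vec.tail eq))
  ∣p∪q∣≡∣p∣+∣q∣ (outside ∷ p) (inside  ∷ q) eq =
    trans (cong suc (∣p∪q∣≡∣p∣+∣q∣ p q (cong Vec.tail eq))) (sym (ℕ.+-suc ∣ p ∣ ∣ q ∣))
  ∣p∪q∣≡∣p∣+∣q∣ (outside ∷ p) (outside ∷ q) eq = ∣p∪q∣≡∣p∣+∣q∣ p q (cong Vec.tail eq)

  p∩[q─p]≡⊥ : (p q : Subset n) → p ∩ (q ─ p) ≡ ⊥
  p∩[q─p]≡⊥ []            []      = refl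
  p∩[q─p]≡⊥ (inside  ∷ p) (_ ∷ q) = cong (outside ∷_) (p∩[q─p]≡⊥ p q)
  p∩[q─p]≡⊥ (outside ∷ p) (_ ∷ q) = cong (outside ∷_) (p∩[q─p]≡⊥ p q)

  p∩[p─q]≡p─q : (p q : Subset n) → p ∩ (p ─ q) ≡ p ─ q
  p∩[p─q]≡p─q []      []            = refl
  p∩[p─q]≡p─q (s ∷ p) (inside  ∷ q) = cong₂ _∷_ (∧-zeroʳ s) (p∩[p─q]≡p─q p q)
  p∩[p─q]≡p─q (s ∷ p) (outside ∷ q) = cong₂ _∷_ (∧-idem s) (p∩[p─q]≡p─q p q)

  p⊆q⇒q∩p≡p : p ⊆ q → q ∩ p ≡ p
  p⊆q⇒q∩p≡p {p = []}          {[]}          _   = refl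
  p⊆q⇒q∩p≡p {p = outside ∷ p} {s ∷ q}       p⊆q = cong₂ _∷_ (∧-zeroʳ s) (p⊆q⇒q∩p≡p (drop-∷-⊆ p⊆q))
  p⊆q⇒q∩p≡p {p = inside  ∷ p} {inside ∷ q}  p⊆q = cong (inside ∷_) (p⊆q⇒q∩p≡p (drop-∷-⊆ p⊆q))
  p⊆q⇒q∩p≡p {p = inside  ∷ p} {outside ∷ q} p⊆q = contradiction (p⊆q here) λ ()

  p⊆q⇒p∪[q─p]≡q : p ⊆ q → p ∪ (q ─ p) ≡ q
  p⊆q⇒p∪[q─p]≡q {p = []}          {[]}          _   = refl
  p⊆q⇒p∪[q─p]≡q {p = outside ∷ p} {s ∷ q}       p⊆q = cong (s ∷_) (p⊆q⇒p∪[q─p]≡q (drop-∷-⊆ p⊆q))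
  p⊆q⇒p∪[q─p]≡q {p = inside  ∷ p} {inside ∷ q}  p⊆q = cong (inside ∷_) (p⊆q⇒p∪[q─p]≡q (drop-∷-⊆ p⊆q))
  p⊆q⇒p∪[q─p]≡q {p = inside  ∷ p} {outside ∷ q} p⊆q = contradiction (p⊆q here) λ ()

  p⊆q⇒∣q─p∣+∣p∣≡∣q∣ : p ⊆ q → ∣ q ─ p ∣ + ∣ p ∣ ≡ ∣ q ∣
  p⊆q⇒∣q─p∣+∣p∣≡∣q∣ {p = []}          {[]}           _   = refl
  p⊆q⇒∣q─p∣+∣p∣≡∣q∣ {p = outside ∷ p} {outside ∷ q}  p⊆q = p⊆q⇒∣q─p∣+∣p∣≡∣q∣ (drop-∷-⊆ p⊆q)
  p⊆q⇒∣q─p∣+∣p∣≡∣q∣ {p = outside ∷ p} {inside  ∷ q}  p⊆q =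
    cong suc (p⊆q⇒∣q─p∣+∣p∣≡∣q∣ (drop-∷-⊆ p⊆q))
  p⊆q⇒∣q─p∣+∣p∣≡∣q∣ {p = inside  ∷ p} {inside  ∷ q}  p⊆q =
    trans (ℕ.+-suc _ _) (cong suc (p⊆q⇒∣q─p∣+∣p∣≡∣q∣ (drop-∷-⊆ p⊆q)))
  p⊆q⇒∣q─p∣+∣p∣≡∣q∣ {p = inside  ∷ p} {outside ∷ q}  p⊆q = contradiction (p⊆q here) λ ()

  p⊆q⇒∣q─p∣<∣q∣ : p ⊆ q → ∀ {m} → ∣ p ∣ ≡ suc m → ∣ q ─ p ∣ < ∣ q ∣
  p⊆q⇒∣q─p∣<∣q∣ {p = p} {q} p⊆q ∣p∣≡1+m =
    subst (∣ q ─ p ∣ <_) (p⊆q⇒∣q─p∣+∣p∣≡∣q∣ p⊆q)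
      (ℕ.m<m+n ∣ q ─ p ∣ (subst (0 <_) (sym ∣p∣≡1+m) (s≤s z≤n)))

  p─q≡p∩∁q : (p q : Subset n) → p ─ q ≡ p ∩ ∁ q
  p─q≡p∩∁q []      []            = refl
  p─q≡p∩∁q (s ∷ p) (inside  ∷ q) = cong₂ _∷_ (sym (∧-zeroʳ s)) (p─q≡p∩∁q p q)
  p─q≡p∩∁q (s ∷ p) (outside ∷ q) = cong₂ _∷_ (sym (∧-identityʳ s)) (p─q≡p∩∁q p q)

  ∈-subsetsOf⁺ : p ⊆ q → p ∈ˡ subsetsOf q
  ∈-subsetsOf⁺ {p = []}          {[]}          _   = hereˡ refl
  ∈-subsetsOf⁺ {p = outside ∷ p} {outside ∷ q} p⊆q = ∈-map⁺ (outside ∷_) (∈-subsetsOf⁺ (drop-∷-⊆ p⊆q))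
  ∈-subsetsOf⁺ {p = outside ∷ p} {inside  ∷ q} p⊆q =
    ∈-++⁺ˡ (∈-map⁺ (outside ∷_) (∈-subsetsOf⁺ (drop-∷-⊆ p⊆q)))
  ∈-subsetsOf⁺ {p = inside  ∷ p} {inside  ∷ q} p⊆q =
    ∈-++⁺ʳ (map (outside ∷_) (subsetsOf q)) (∈-map⁺ (inside ∷_) (∈-subsetsOf⁺ (drop-∷-⊆ p⊆q)))
  ∈-subsetsOf⁺ {p = inside  ∷ p} {outside ∷ q} p⊆q = contradiction (p⊆q here) λ ()

  ∈-subsetsOf⁻ : (q : Subset n) → p ∈ˡ subsetsOf q → p ⊆ q
  ∈-subsetsOf⁻ []            (hereˡ refl) = ⊆-refl
  ∈-subsetsOf⁻ (outside ∷ q) p∈ with ∈-map⁻ (outside ∷_) p∈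
  ... | _ , p′∈ , refl = out⊆ (∈-subsetsOf⁻ q p′∈)
  ∈-subsetsOf⁻ (inside ∷ q)  p∈ with ∈-++⁻ (map (outside ∷_) (subsetsOf q)) p∈
  ... | inj₁ p∈₁ with ∈-map⁻ (outside ∷_) p∈₁
  ...   | _ , p′∈ , refl = out⊆ (∈-subsetsOf⁻ q p′∈)
  ∈-subsetsOf⁻ (inside ∷ q)  p∈ | inj₂ p∈₂ with ∈-map⁻ (inside ∷_) p∈₂
  ...   | _ , p′∈ , refl = s⊆s (∈-subsetsOf⁻ q p′∈)

  subsetsOf-unique : (q : Subset n) → Unique (subsetsOf q)
  subsetsOf-unique []            = [] ∷ []
  subsetsOf-unique (outside ∷ q) = Unique.map⁺ Vec.∷-injectiveʳ (subsetsOf-unique q)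
  subsetsOf-unique (inside ∷ q)  =
    Unique.++⁺ (Unique.map⁺ Vec.∷-injectiveʳ (subsetsOf-unique q)) (Unique.map⁺ Vec.∷-injectiveʳ (subsetsOf-unique q))
      heads-differ
    where
    heads-differ : ∀ {r} → ¬ (r ∈ˡ map (outside ∷_) (subsetsOf q) × r ∈ˡ map (inside ∷_) (subsetsOf q))
    heads-differ (r∈₁ , r∈₂) with ∈-map⁻ (outside ∷_) r∈₁ | ∈-map⁻ (inside ∷_) r∈₂
    ... | _ , _ , refl | _ , _ , ()


module Parking where

  open import Data.Nat using (ℕ; zero; suc; _+_; _≤_; z≤n; s≤s; _<ᵇ_)
  import Data.Nat.Properties as ℕ
  open import Data.Bool using (true; false)
  open import Data.Fin.Subset using (Subset; ⊥; _∩_; _∪_; ∣_∣)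
  open import Data.Fin.Subset.Properties using (∣p∩q∣≤∣p∣; ∩-zeroʳ; ∪-identityˡ; ∣⊥∣≡0)
  open import Data.List using ([]; _∷_; _++_; map; length; take; [_])
  open import Data.List.Properties using (++-identityʳ; ++-assoc)
  open import Data.List.Membership.Propositional using (_∈_)
  open import Data.List.Relation.Unary.Any using (here; there)
  open import Data.Product using (_,_)
  open import Data.Unit using (tt)
  open import Relation.Nullary using (contradiction)
  open import Relation.Binary.PropositionalEquality hiding ([_])
  open Subsets

  private variable
    n d e : ℕ
    B R : Subset n
    Γ Δ : WSC n

  -- parkFrom d runs park from a state of surplus d = |Φ| − ℓ(Φ): a block B is kept iff
  -- d + |B| ≥ 1, and a dropped block is empty, so dropping it leaves the surplus unchanged.
  parkFrom : ℕ → WSC n → WSC n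
  parkFrom d []      = []
  parkFrom d (B ∷ Γ) with d + ∣ B ∣
  ... | zero  = parkFrom d Γ
  ... | suc e = B ∷ parkFrom e Γ

  surplus : ℕ → WSC n → ℕ
  surplus d []      = d
  surplus d (B ∷ Γ) with d + ∣ B ∣
  ... | zero  = surplus d Γ
  ... | suc e = surplus e Γ

  n<ᵇn≡false : ∀ n → (n <ᵇ n) ≡ false
  n<ᵇn≡false zero    = refl
  n<ᵇn≡false (suc n) = n<ᵇn≡false n

  n<ᵇn+1+k≡true : ∀ n k → (n <ᵇ n + suc k) ≡ true
  n<ᵇn+1+k≡true zero    k = refl
  n<ᵇn+1+k≡true (suc n) k = n<ᵇn+1+k≡true n k

  parkAux≡parkFrom : ∀ (acc : WSC n) len d Γ → parkAux acc (len + d) len Γ ≡ acc ++ parkFrom d Γ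
  parkAux≡parkFrom acc len d []      = sym (++-identityʳ acc)
  parkAux≡parkFrom acc len d (B ∷ Γ) rewrite ℕ.+-assoc len d ∣ B ∣ with d + ∣ B ∣
  ... | zero  rewrite ℕ.+-identityʳ len | n<ᵇn≡false len = parkAux≡parkFrom acc len d Γ
  ... | suc e rewrite n<ᵇn+1+k≡true len e | ℕ.+-suc len e =
    trans (parkAux≡parkFrom (acc ++ [ B ]) (suc len) e Γ) (++-assoc acc [ B ] _)

  park≡parkFrom : (Γ : WSC n) → park Γ ≡ parkFrom 0 Γ
  park≡parkFrom = parkAux≡parkFrom [] 0 0

  module _ (f : Subset n → Subset n) (∣f∣ : ∀ B → ∣ f B ∣ ≡ ∣ B ∣) where

    parkFrom-map : ∀ d Γ → parkFrom d (map f Γ) ≡ map f (parkFrom d Γ)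
    parkFrom-map d []      = refl
    parkFrom-map d (B ∷ Γ) rewrite ∣f∣ B with d + ∣ B ∣
    ... | zero  = parkFrom-map d Γ
    ... | suc e = cong (f B ∷_) (parkFrom-map e Γ)

  parkFrom-restrict-parkFrom : e ≤ d → ∀ Γ → parkFrom e (restrict (parkFrom d Γ) R) ≡ parkFrom e (restrict Γ R)
  parkFrom-restrict-parkFrom e≤d [] = refl
  parkFrom-restrict-parkFrom {e = e} {d = d} {R = R} e≤d (B ∷ Γ) with d + ∣ B ∣ | ℕ.+-mono-≤ e≤d (∣p∩q∣≤∣p∣ B R)
  ... | zero | bound with e + ∣ B ∩ R ∣ | bound
  ...   | zero | _ = parkFrom-restrict-parkFrom e≤d Γ
  parkFrom-restrict-parkFrom {e = e} {d = d} {R = R} e≤d (B ∷ Γ) | suc d′ | bound with e + ∣ B ∩ R ∣ in eq | bound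
  ... | zero   | _         = parkFrom-restrict-parkFrom (subst (_≤ d′) (sym (ℕ.m+n≡0⇒m≡0 e eq)) z≤n) Γ
  ... | suc e′ | s≤s e′≤d′ = cong (B ∩ R ∷_) (parkFrom-restrict-parkFrom e′≤d′ Γ)

  surplus-restrict-≤ : e ≤ d → ∀ Γ → surplus e (restrict Γ R) ≤ surplus d Γ
  surplus-restrict-≤ e≤d [] = e≤d
  surplus-restrict-≤ {e = e} {d = d} {R = R} e≤d (B ∷ Γ) with d + ∣ B ∣ | ℕ.+-mono-≤ e≤d (∣p∩q∣≤∣p∣ B R)
  ... | zero | bound with e + ∣ B ∩ R ∣ | bound
  ...   | zero | _ = surplus-restrict-≤ e≤d Γ
  surplus-restrict-≤ {e = e} {d = d} {R = R} e≤d (B ∷ Γ) | suc d′ | bound with e + ∣ B ∩ R ∣ in eq | bound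
  ... | zero   | _         = surplus-restrict-≤ (subst (_≤ d′) (sym (ℕ.m+n≡0⇒m≡0 e eq)) z≤n) Γ
  ... | suc e′ | s≤s e′≤d′ = surplus-restrict-≤ e′≤d′ Γ

  parkFrom-++ : ∀ d (Γ Δ : WSC n) → parkFrom d (Γ ++ Δ) ≡ parkFrom d Γ ++ parkFrom (surplus d Γ) Δ
  parkFrom-++ d []      Δ = refl
  parkFrom-++ d (B ∷ Γ) Δ with d + ∣ B ∣
  ... | zero  = parkFrom-++ d Γ Δ
  ... | suc e = cong (B ∷_) (parkFrom-++ e Γ Δ)

  length-parkFrom+surplus : ∀ d (Γ : WSC n) → length (parkFrom d Γ) + surplus d Γ ≡ d + size Γ
  length-parkFrom+surplus d []      = sym (ℕ.+-identityʳ d)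
  length-parkFrom+surplus d (B ∷ Γ) with d + ∣ B ∣ in eq
  ... | zero  = begin
    length (parkFrom d Γ) + surplus d Γ ≡⟨ length-parkFrom+surplus d Γ ⟩
    d + size Γ                          ≡⟨ cong (λ b → d + (b + size Γ)) (ℕ.m+n≡0⇒n≡0 d eq) ⟨
    d + (∣ B ∣ + size Γ)                ∎
    where open ≡-Reasoning
  ... | suc e = begin
    suc (length (parkFrom e Γ) + surplus e Γ) ≡⟨ cong suc (length-parkFrom+surplus e Γ) ⟩
    suc e + size Γ                            ≡⟨ cong (_+ size Γ) eq ⟨
    d + ∣ B ∣ + size Γ                        ≡⟨ ℕ.+-assoc d ∣ B ∣ (size Γ) ⟩
    d + (∣ B ∣ + size Γ)                      ∎
    where open ≡-Reasoning

  data ParkedFrom {n} : ℕ → WSC n → Set where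
    []   : ParkedFrom d []
    keep : d + ∣ B ∣ ≡ suc e → ParkedFrom e Γ → ParkedFrom d (B ∷ Γ)

  parkFrom-parkedFrom : ∀ d (Γ : WSC n) → ParkedFrom d (parkFrom d Γ)
  parkFrom-parkedFrom d []      = []
  parkFrom-parkedFrom d (B ∷ Γ) with d + ∣ B ∣ in eq
  ... | zero  = parkFrom-parkedFrom d Γ
  ... | suc e = keep eq (parkFrom-parkedFrom e Γ)

  parkedFrom⇒parkFrom≡id : ParkedFrom d Γ → parkFrom d Γ ≡ Γ
  parkedFrom⇒parkFrom≡id []                  = refl
  parkedFrom⇒parkFrom≡id (keep eq p) rewrite eq = cong (_ ∷_) (parkedFrom⇒parkFrom≡id p)

  parkedFrom-mono : d ≤ e → ParkedFrom d Γ → ParkedFrom e Γ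
  parkedFrom-mono d≤e []                         = []
  parkedFrom-mono {e = e} d≤e (keep {B = B} eq p) with e + ∣ B ∣ in eq′ | ℕ.+-monoˡ-≤ ∣ B ∣ d≤e
  ... | zero   | bound = contradiction (subst (_≤ 0) eq bound) λ ()
  ... | suc e′ | bound = keep eq′ (parkedFrom-mono (ℕ.≤-pred (subst (_≤ suc e′) eq bound)) p)

  parkedFrom-++ : ParkedFrom d Γ → ParkedFrom 0 Δ → ParkedFrom d (Γ ++ Δ)
  parkedFrom-++ []          q = parkedFrom-mono z≤n q
  parkedFrom-++ (keep eq p) q = keep eq (parkedFrom-++ p q)

  PrefixCondition : ℕ → WSC n → Set
  PrefixCondition d Γ = ∀ k → k ≤ length Γ → k ≤ d + size (take k Γ)

  prefixCondition-∷ : PrefixCondition d (B ∷ Γ) → ∀ k → k ≤ length Γ → suc k ≤ d + ∣ B ∣ + size (take k Γ)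
  prefixCondition-∷ {d = d} {B = B} {Γ = Γ} pre k k≤ =
    subst (suc k ≤_) (sym (ℕ.+-assoc d ∣ B ∣ (size (take k Γ)))) (pre (suc k) (s≤s k≤))

  prefix⇒parkedFrom : ∀ d (Γ : WSC n) → PrefixCondition d Γ → ParkedFrom d Γ
  prefix⇒parkedFrom d []      _   = []
  prefix⇒parkedFrom d (B ∷ Γ) pre with d + ∣ B ∣ in eq | prefixCondition-∷ pre
  ... | zero  | pre′ = contradiction (pre′ 0 z≤n) λ ()
  ... | suc e | pre′ = keep eq (prefix⇒parkedFrom e Γ λ k k≤ → ℕ.≤-pred (pre′ k k≤))

  parkedFrom⇒prefix : ParkedFrom d Γ → PrefixCondition d Γ
  parkedFrom⇒prefix p zero _ = z≤n
  parkedFrom⇒prefix {d = d} (keep {B = B} {Γ = Γ} eq p) (suc k) (s≤s k≤) =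
    subst (suc k ≤_) (trans (cong (_+ size (take k Γ)) (sym eq)) (ℕ.+-assoc d ∣ B ∣ _))
      (s≤s (parkedFrom⇒prefix p k k≤))

  ∈-parkFrom⁻ : ∀ d (Γ : WSC n) → B ∈ parkFrom d Γ → B ∈ Γ
  ∈-parkFrom⁻ d (C ∷ Γ) B∈ with d + ∣ C ∣ | B∈
  ... | zero  | B∈′        = there (∈-parkFrom⁻ d Γ B∈′)
  ... | suc e | here B≡C   = here B≡C
  ... | suc e | there B∈′  = there (∈-parkFrom⁻ e Γ B∈′)

  unionW-parkFrom : ∀ d (Γ : WSC n) → unionW (parkFrom d Γ) ≡ unionW Γ
  unionW-parkFrom d []      = refl
  unionW-parkFrom d (B ∷ Γ) with d + ∣ B ∣ in eq
  ... | zero  rewrite ∣p∣≡0⇒p≡⊥ B (ℕ.m+n≡0⇒n≡0 d eq) = trans (unionW-parkFrom d Γ) (sym (∪-identityˡ _))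
  ... | suc e = cong (B ∪_) (unionW-parkFrom e Γ)

  pairwiseDisjoint-parkFrom : ∀ d (Γ : WSC n) → PairwiseDisjoint Γ → PairwiseDisjoint (parkFrom d Γ)
  pairwiseDisjoint-parkFrom d []      _             = tt
  pairwiseDisjoint-parkFrom d (B ∷ Γ) (B⊥Γ , disjΓ) with d + ∣ B ∣
  ... | zero  = pairwiseDisjoint-parkFrom d Γ disjΓ
  ... | suc e = (λ C C∈ → B⊥Γ C (∈-parkFrom⁻ e Γ C∈)) , pairwiseDisjoint-parkFrom e Γ disjΓ

  parkFrom-restrict-⊥ : (Γ : WSC n) → parkFrom 0 (restrict Γ ⊥) ≡ []
  parkFrom-restrict-⊥     []      = refl
  parkFrom-restrict-⊥ {n} (B ∷ Γ) rewrite ∩-zeroʳ B | ∣⊥∣≡0 n = parkFrom-restrict-⊥ Γ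


module WeakSetCompositions where

  open import Data.Nat using (ℕ; _+_)
  open import Data.Fin.Subset using (Subset; ⊥; _∩_; _∪_; ∣_∣)
  open import Data.Fin.Subset.Properties
    using ( ∣⊥∣≡0; ∪-comm; ∩-assoc; ∩-zeroʳ; ∩-zeroˡ; ∪-assoc; ∪-identityˡ; ∩-distribˡ-∪; ∩-distribʳ-∪
          ; ∩-abs-∪; ∪-abs-∩; ∩-commutativeMonoid)
  import Algebra.Properties.CommutativeSemigroup as CommutativeSemigroupProperties
  open import Algebra.Bundles using (CommutativeMonoid)
  open import Data.List using ([]; _∷_; _++_)
  open import Data.List.Properties using (map-∘; map-cong)
  open import Data.List.Membership.Propositional using (_∈_)
  open import Data.List.Membership.Propositional.Properties using (∈-map⁻; ∈-++⁻)
  open import Data.List.Relation.Unary.Any using (here; there)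
  open import Data.Product using (_,_)
  open import Data.Sum using (inj₁; inj₂)
  open import Data.Unit using (tt)
  open import Relation.Binary.PropositionalEquality
  open Subsets

  private variable
    n : ℕ

  ∩-interchange : (A B C D : Subset n) → (A ∩ B) ∩ (C ∩ D) ≡ (A ∩ C) ∩ (B ∩ D)
  ∩-interchange {n} = CommutativeSemigroupProperties.interchange (CommutativeMonoid.commutativeSemigroup (∩-commutativeMonoid n))

  ∩-unionW : (Γ : WSC n) {B : Subset n} → B ∈ Γ → B ∩ unionW Γ ≡ B
  ∩-unionW (C ∷ Γ)     (here refl) = ∩-abs-∪ C (unionW Γ)
  ∩-unionW (C ∷ Γ) {B} (there B∈) = begin
    B ∩ (C ∪ unionW Γ)            ≡⟨ ∩-distribˡ-∪ B C (unionW Γ) ⟩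
    (B ∩ C) ∪ (B ∩ unionW Γ)      ≡⟨ cong ((B ∩ C) ∪_) (∩-unionW Γ B∈) ⟩
    (B ∩ C) ∪ B                   ≡⟨ ∪-comm (B ∩ C) B ⟩
    B ∪ (B ∩ C)                   ≡⟨ ∪-abs-∩ B C ⟩
    B                             ∎
    where open ≡-Reasoning

  ∩-unionW-disjoint : (A : Subset n) (Γ : WSC n) → (∀ B → B ∈ Γ → A ∩ B ≡ ⊥) → A ∩ unionW Γ ≡ ⊥
  ∩-unionW-disjoint A []      _     = ∩-zeroʳ A
  ∩-unionW-disjoint A (B ∷ Γ) A⊥Γ = begin
    A ∩ (B ∪ unionW Γ)       ≡⟨ ∩-distribˡ-∪ A B (unionW Γ) ⟩
    (A ∩ B) ∪ (A ∩ unionW Γ)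
      ≡⟨ cong₂ _∪_ (A⊥Γ B (here refl)) (∩-unionW-disjoint A Γ λ C C∈ → A⊥Γ C (there C∈)) ⟩
    ⊥ ∪ ⊥                    ≡⟨ ∪-identityˡ ⊥ ⟩
    ⊥                        ∎
    where open ≡-Reasoning

  size≡∣unionW∣ : (Γ : WSC n) → PairwiseDisjoint Γ → size Γ ≡ ∣ unionW Γ ∣
  size≡∣unionW∣ {n} []      _             = sym (∣⊥∣≡0 n)
  size≡∣unionW∣     (A ∷ Γ) (A⊥Γ , disjΓ) = begin
    ∣ A ∣ + size Γ           ≡⟨ cong (∣ A ∣ +_) (size≡∣unionW∣ Γ disjΓ) ⟩
    ∣ A ∣ + ∣ unionW Γ ∣     ≡⟨ ∣p∪q∣≡∣p∣+∣q∣ A (unionW Γ) (∩-unionW-disjoint A Γ A⊥Γ) ⟨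
    ∣ A ∪ unionW Γ ∣         ∎
    where open ≡-Reasoning

  pairwiseDisjoint-restrict : (Γ : WSC n) (V : Subset n) → PairwiseDisjoint Γ → PairwiseDisjoint (restrict Γ V)
  pairwiseDisjoint-restrict []      V _             = tt
  pairwiseDisjoint-restrict (A ∷ Γ) V (A⊥Γ , disjΓ) = A∩V⊥ , pairwiseDisjoint-restrict Γ V disjΓ
    where
    A∩V⊥ : ∀ B′ → B′ ∈ restrict Γ V → (A ∩ V) ∩ B′ ≡ ⊥
    A∩V⊥ B′ B′∈ with ∈-map⁻ (_∩ V) B′∈
    ... | B , B∈ , refl = trans (∩-interchange A V B V) (trans (cong (_∩ (V ∩ V)) (A⊥Γ B B∈)) (∩-zeroˡ _))

  unionW-restrict : (Γ : WSC n) (V : Subset n) → unionW (restrict Γ V) ≡ unionW Γ ∩ V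
  unionW-restrict []      V = sym (∩-zeroˡ V)
  unionW-restrict (B ∷ Γ) V = trans (cong ((B ∩ V) ∪_) (unionW-restrict Γ V)) (sym (∩-distribʳ-∪ V B (unionW Γ)))

  restrict-restrict : (x : WSC n) (V W : Subset n) → restrict (restrict x V) W ≡ restrict x (V ∩ W)
  restrict-restrict x V W = trans (sym (map-∘ x)) (map-cong (λ A → ∩-assoc A V W) x)

  pairwiseDisjoint-++ : (Γ Δ : WSC n) → PairwiseDisjoint Γ → PairwiseDisjoint Δ →
                        (∀ A → A ∈ Γ → ∀ B → B ∈ Δ → A ∩ B ≡ ⊥) → PairwiseDisjoint (Γ ++ Δ)
  pairwiseDisjoint-++ []      Δ _             disjΔ _     = disjΔ
  pairwiseDisjoint-++ (A ∷ Γ) Δ (A⊥Γ , disjΓ) disjΔ Γ⊥Δ =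
    A⊥Γ++Δ , pairwiseDisjoint-++ Γ Δ disjΓ disjΔ (λ A′ A′∈ → Γ⊥Δ A′ (there A′∈))
    where
    A⊥Γ++Δ : ∀ B → B ∈ Γ ++ Δ → A ∩ B ≡ ⊥
    A⊥Γ++Δ B B∈ with ∈-++⁻ Γ B∈
    ... | inj₁ B∈Γ = A⊥Γ B B∈Γ
    ... | inj₂ B∈Δ = Γ⊥Δ A (here refl) B B∈Δ

  unionW-++ : (Γ Δ : WSC n) → unionW (Γ ++ Δ) ≡ unionW Γ ∪ unionW Δ
  unionW-++ []      Δ = sym (∪-identityˡ _)
  unionW-++ (A ∷ Γ) Δ = trans (cong (A ∪_) (unionW-++ Γ Δ)) (sym (∪-assoc A _ _))


module ParkingFunctions where

  open import Data.Nat using (ℕ; zero; _+_; _≤_; z≤n)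
  import Data.Nat.Properties as ℕ
  open import Data.Fin.Subset using (Subset; ⊥; _∩_; _∪_; _─_; ∣_∣; _⊆_)
  open import Data.Fin.Subset.Properties using (∪-comm; p⊆p∪q; q⊆p∪q; ∩-comm; ∩-assoc; ∩-zeroʳ; ∩-abs-∪)
  open import Data.List using ([]; _++_; length)
  open import Data.List.Properties using (map-++; length-++; map-cong-local; map-id-local)
  open import Data.List.Membership.Propositional using (_∈_)
  import Data.List.Relation.Unary.All as All
  open import Data.Product using (_×_; _,_; proj₁; proj₂)
  open import Data.Unit using (tt)
  open import Relation.Binary.PropositionalEquality
  open Subsets
  open Parking
  open WeakSetCompositions

  private variable
    n : ℕ
    I S T V W : Subset n
    x y : WSC n

  infixl 20 _↾_

  _↾_ : WSC n → Subset n → WSC n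
  x ↾ V = park (restrict x V)

  ↾-↾ : (x : WSC n) (V W : Subset n) → (x ↾ V) ↾ W ≡ x ↾ (V ∩ W)
  ↾-↾ x V W = begin
    park (restrict (park (restrict x V)) W)
      ≡⟨ park≡parkFrom (restrict (x ↾ V) W) ⟩
    parkFrom 0 (restrict (park (restrict x V)) W)
      ≡⟨ cong (λ Γ → parkFrom 0 (restrict Γ W)) (park≡parkFrom (restrict x V)) ⟩
    parkFrom 0 (restrict (parkFrom 0 (restrict x V)) W) ≡⟨ parkFrom-restrict-parkFrom z≤n (restrict x V) ⟩
    parkFrom 0 (restrict (restrict x V) W)              ≡⟨ cong (parkFrom 0) (restrict-restrict x V W) ⟩
    parkFrom 0 (restrict x (V ∩ W))                     ≡⟨ park≡parkFrom (restrict x (V ∩ W)) ⟨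
    park (restrict x (V ∩ W))                           ∎
    where open ≡-Reasoning

  ↾-↾-⊆ : (x : WSC n) {S V : Subset n} → S ⊆ V → (x ↾ V) ↾ S ≡ x ↾ S
  ↾-↾-⊆ x {S} {V} S⊆V = trans (↾-↾ x V S) (cong (x ↾_) (p⊆q⇒q∩p≡p S⊆V))

  ↾-↾-─ : (x : WSC n) (V T : Subset n) → (x ↾ V) ↾ (V ─ T) ≡ x ↾ (V ─ T)
  ↾-↾-─ x V T = trans (↾-↾ x V (V ─ T)) (cong (x ↾_) (p∩[p─q]≡p─q V T))

  ↾-⊥ : (x : WSC n) → x ↾ ⊥ ≡ []
  ↾-⊥ x = trans (park≡parkFrom (restrict x ⊥)) (parkFrom-restrict-⊥ x)

  ↾-coassoc : (x : WSC n) (R S T : Subset n) →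
    ((x ↾ (R ∪ S) ↾ R , x ↾ (R ∪ S) ↾ S) , x ↾ T) ≡ ((x ↾ R , x ↾ (S ∪ T) ↾ S) , x ↾ (S ∪ T) ↾ T)
  ↾-coassoc x R S T = cong₂ _,_
    (cong₂ _,_ (↾-↾-⊆ x (p⊆p∪q S)) (trans (↾-↾-⊆ x (q⊆p∪q R S)) (sym (↾-↾-⊆ x (p⊆p∪q T)))))
    (sym (↾-↾-⊆ x (q⊆p∪q S T)))

  pf-empty : (I : Subset n) → ∣ I ∣ ≡ 0 → IsPF I []
  pf-empty I ∣I∣≡0 = (tt , sym (∣p∣≡0⇒p≡⊥ I ∣I∣≡0)) , sym ∣I∣≡0 , λ { zero _ → z≤n }

  module _ {I : Subset n} {x : WSC n} (pf : IsPF I x) where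

    private
      disjoint : PairwiseDisjoint x
      disjoint = proj₁ (proj₁ pf)
      union : unionW x ≡ I
      union = proj₂ (proj₁ pf)
      len : length x ≡ ∣ I ∣
      len = proj₁ (proj₂ pf)

    pf-block : {B : Subset n} → B ∈ x → B ∩ I ≡ B
    pf-block B∈ = subst (λ U → _ ∩ U ≡ _) union (∩-unionW x B∈)

    pf-parkedFrom : ParkedFrom 0 x
    pf-parkedFrom = prefix⇒parkedFrom 0 x (proj₂ (proj₂ pf))

    pf-size : size x ≡ length x
    pf-size = trans (size≡∣unionW∣ x disjoint) (trans (cong ∣_∣ union) (sym len))

    pf-surplus : surplus 0 x ≡ 0
    pf-surplus = ℕ.+-cancelˡ-≡ (length x) _ _ (begin
      length x + surplus 0 x              ≡⟨ cong (λ Γ → length Γ + surplus 0 x) (parkedFrom⇒parkFrom≡id pf-parkedFrom) ⟨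
      length (parkFrom 0 x) + surplus 0 x ≡⟨ length-parkFrom+surplus 0 x ⟩
      size x                              ≡⟨ pf-size ⟩
      length x                            ≡⟨ ℕ.+-identityʳ (length x) ⟨
      length x + 0                        ∎)
      where open ≡-Reasoning

    pf-surplus-restrict : (V : Subset n) → surplus 0 (restrict x V) ≡ 0
    pf-surplus-restrict V = ℕ.n≤0⇒n≡0 (subst (surplus 0 (restrict x V) ≤_) pf-surplus (surplus-restrict-≤ z≤n x))

    pf-↾-self : x ↾ I ≡ x
    pf-↾-self = begin
      park (restrict x I) ≡⟨ park≡parkFrom (restrict x I) ⟩
      parkFrom 0 (restrict x I) ≡⟨ cong (parkFrom 0) (map-id-local (All.tabulate pf-block)) ⟩
      parkFrom 0 x ≡⟨ parkedFrom⇒parkFrom≡id pf-parkedFrom ⟩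
      x ∎
      where open ≡-Reasoning

    pf-↾-∩ : (V : Subset n) → x ↾ (I ∩ V) ≡ x ↾ V
    pf-↾-∩ V = cong park (map-cong-local (All.tabulate λ {A} A∈ → trans (sym (∩-assoc A I V)) (cong (_∩ V) (pf-block A∈))))

    pf-↾ : (V : Subset n) → IsPF (I ∩ V) (x ↾ V)
    pf-↾ V = subst (IsPF (I ∩ V)) (sym (park≡parkFrom Γ))
      ((disjoint′ , union′) , len′ , parkedFrom⇒prefix (parkFrom-parkedFrom 0 Γ))
      where
      Γ = restrict x V
      union-Γ : unionW Γ ≡ I ∩ V
      union-Γ = trans (unionW-restrict x V) (cong (_∩ V) union)
      disjoint′ : PairwiseDisjoint (parkFrom 0 Γ)
      disjoint′ = pairwiseDisjoint-parkFrom 0 Γ (pairwiseDisjoint-restrict x V disjoint)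
      union′ : unionW (parkFrom 0 Γ) ≡ I ∩ V
      union′ = trans (unionW-parkFrom 0 Γ) union-Γ
      len′ : length (parkFrom 0 Γ) ≡ ∣ I ∩ V ∣
      len′ = begin
        length (parkFrom 0 Γ)                   ≡⟨ ℕ.+-identityʳ _ ⟨
        length (parkFrom 0 Γ) + 0               ≡⟨ cong (length (parkFrom 0 Γ) +_) (pf-surplus-restrict V) ⟨
        length (parkFrom 0 Γ) + surplus 0 Γ     ≡⟨ length-parkFrom+surplus 0 Γ ⟩
        size Γ                                  ≡⟨ size≡∣unionW∣ Γ (pairwiseDisjoint-restrict x V disjoint) ⟩
        ∣ unionW Γ ∣                            ≡⟨ cong ∣_∣ union-Γ ⟩
        ∣ I ∩ V ∣                               ∎
        where open ≡-Reasoning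

  pf-↾-─ : IsPF I x → (S : Subset n) → IsPF (I ─ S) (x ↾ (I ─ S))
  pf-↾-─ {I = I} {x = x} pf S = subst (λ J → IsPF J (x ↾ (I ─ S))) (p∩[p─q]≡p─q I S) (pf-↾ pf (I ─ S))

  pf-Δ : IsPF (S ∪ T) x → IsPF S (x ↾ S) × IsPF T (x ↾ T)
  pf-Δ {S = S} {T = T} {x = x} pf =
    subst (λ J → IsPF J (x ↾ S)) (trans (∩-comm (S ∪ T) S) (∩-abs-∪ S T)) (pf-↾ pf S) ,
    subst (λ J → IsPF J (x ↾ T)) (trans (∩-comm (S ∪ T) T) (trans (cong (T ∩_) (∪-comm S T)) (∩-abs-∪ T S))) (pf-↾ pf T)

  pf-++ : S ∩ T ≡ ⊥ → IsPF S x → IsPF T y → IsPF (S ∪ T) (x ++ y)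
  pf-++ {S = S} {T} {x} {y} S⊥T pfx pfy =
    ( pairwiseDisjoint-++ x y (proj₁ (proj₁ pfx)) (proj₁ (proj₁ pfy)) x⊥y
    , trans (unionW-++ x y) (cong₂ _∪_ (proj₂ (proj₁ pfx)) (proj₂ (proj₁ pfy))) )
    , trans (length-++ x)
        (trans (cong₂ _+_ (proj₁ (proj₂ pfx)) (proj₁ (proj₂ pfy))) (sym (∣p∪q∣≡∣p∣+∣q∣ S T S⊥T)))
    , parkedFrom⇒prefix (parkedFrom-++ (pf-parkedFrom pfx) (pf-parkedFrom pfy))
    where
    x⊥y : ∀ A → A ∈ x → ∀ B → B ∈ y → A ∩ B ≡ ⊥
    x⊥y A A∈ B B∈ = begin
      A ∩ B             ≡⟨ cong₂ _∩_ (pf-block pfx A∈) (pf-block pfy B∈) ⟨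
      (A ∩ S) ∩ (B ∩ T) ≡⟨ ∩-interchange A S B T ⟩
      (A ∩ B) ∩ (S ∩ T) ≡⟨ cong ((A ∩ B) ∩_) S⊥T ⟩
      (A ∩ B) ∩ ⊥       ≡⟨ ∩-zeroʳ _ ⟩
      ⊥                 ∎
      where open ≡-Reasoning

  pf-↾-++ : IsPF I x → S ⊆ I → IsPF (I ─ S) y → IsPF I (x ↾ S ++ y)
  pf-↾-++ {I = I} {x = x} {S = S} {y = y} pfx S⊆I pfy = subst (λ J → IsPF J (x ↾ S ++ y)) (p⊆q⇒p∪[q─p]≡q S⊆I)
    (pf-++ (p∩[q─p]≡⊥ S I) (subst (λ J → IsPF J (x ↾ S)) (p⊆q⇒q∩p≡p S⊆I) (pf-↾ pfx S)) pfy)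

  ++-↾ : IsPF S x → IsPF T y → (V : Subset n) → (x ++ y) ↾ V ≡ x ↾ (S ∩ V) ++ y ↾ (T ∩ V)
  ++-↾ {x = x} {y = y} pfx pfy V = begin
    park (restrict (x ++ y) V)                                ≡⟨ park≡parkFrom (restrict (x ++ y) V) ⟩
    parkFrom 0 (restrict (x ++ y) V)                          ≡⟨ cong (parkFrom 0) (map-++ (_∩ V) x y) ⟩
    parkFrom 0 (restrict x V ++ restrict y V)                 ≡⟨ parkFrom-++ 0 (restrict x V) (restrict y V) ⟩
    parkFrom 0 (restrict x V) ++ parkFrom (surplus 0 (restrict x V)) (restrict y V)
      ≡⟨ cong (λ d → parkFrom 0 (restrict x V) ++ parkFrom d (restrict y V)) (pf-surplus-restrict pfx V) ⟩
    parkFrom 0 (restrict x V) ++ parkFrom 0 (restrict y V)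
      ≡⟨ cong₂ _++_ (park≡parkFrom (restrict x V)) (park≡parkFrom (restrict y V)) ⟨
    x ↾ V ++ y ↾ V                                            ≡⟨ cong₂ _++_ (pf-↾-∩ pfx V) (pf-↾-∩ pfy V) ⟨
    x ↾ (_ ∩ V) ++ y ↾ (_ ∩ V)                                ∎
    where open ≡-Reasoning


module Relabelling where

  open import Data.Nat using (ℕ; suc; _+_; _≤_)
  import Data.Nat.Properties as ℕ
  open import Data.Bool using (Bool; if_then_else_; not)
  open import Data.Fin using (Fin)
  open import Data.Vec using (Vec; []; _∷_; lookup; zipWith)
  import Data.Vec.Properties as Vec
  open import Data.Fin.Subset using (Subset; inside; outside; ⊥; _∩_; _∪_; _─_; ∁; ∣_∣; _⊆_)
  open import Data.Fin.Permutation using (Permutation′; _⟨$⟩ˡ_; _∘ₚ_; flip; inverseˡ; inverseʳ)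
  import Data.Fin.Permutation as Perm
  open import Algebra.Properties.CommutativeMonoid.Sum ℕ.+-0-commutativeMonoid using (sum; sum-permute; sum-cong-≗)
  open import Data.List using ([]; _∷_; map; take)
  open import Data.List.Properties using (map-∘; map-cong; map-id; length-map; take-map; map-injective)
  open import Data.List.Membership.Propositional using (_∈_)
  open import Data.List.Membership.Propositional.Properties using (∈-map⁺; ∈-map⁻)
  open import Data.List.Membership.Propositional.Properties.WithK using (unique∧set⇒bag)
  open import Data.List.Relation.Binary.BagAndSetEquality using (∼bag⇒↭)
  open import Data.List.Relation.Binary.Permutation.Propositional using (_↭_)
  import Data.List.Relation.Unary.Unique.Propositional.Properties as Unique
  open import Data.Product using (_,_)
  open import Data.Unit using (tt)
  open import Function using (_∘_; mk⇔)
  open import Relation.Binary.PropositionalEquality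
  open Subsets
  open Parking
  open ParkingFunctions

  private variable
    n : ℕ
    A B I : Subset n

  lookup-ext : {u v : Vec Bool n} → (∀ i → lookup u i ≡ lookup v i) → u ≡ v
  lookup-ext {u = u} {v} u≗v = trans (sym (Vec.tabulate∘lookup u)) (trans (Vec.tabulate-cong u≗v) (Vec.tabulate∘lookup v))

  lookup-actS : (σ : Permutation′ n) (A : Subset n) (i : Fin n) → lookup (actS σ A) i ≡ lookup A (σ ⟨$⟩ˡ i)
  lookup-actS σ A = Vec.lookup∘tabulate _

  actS-zipWith : (σ : Permutation′ n) (f : Bool → Bool → Bool) (A B : Subset n) →
                 actS σ (zipWith f A B) ≡ zipWith f (actS σ A) (actS σ B)
  actS-zipWith σ f A B = lookup-ext λ i → begin
    lookup (actS σ (zipWith f A B)) i             ≡⟨ lookup-actS σ (zipWith f A B) i ⟩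
    lookup (zipWith f A B) (σ ⟨$⟩ˡ i)             ≡⟨ Vec.lookup-zipWith f (σ ⟨$⟩ˡ i) A B ⟩
    f (lookup A (σ ⟨$⟩ˡ i)) (lookup B (σ ⟨$⟩ˡ i)) ≡⟨ cong₂ f (lookup-actS σ A i) (lookup-actS σ B i) ⟨
    f (lookup (actS σ A) i) (lookup (actS σ B) i) ≡⟨ Vec.lookup-zipWith f i (actS σ A) (actS σ B) ⟨
    lookup (zipWith f (actS σ A) (actS σ B)) i    ∎
    where open ≡-Reasoning

  actS-∩ : (σ : Permutation′ n) (A B : Subset n) → actS σ (A ∩ B) ≡ actS σ A ∩ actS σ B
  actS-∩ σ = actS-zipWith σ _

  actS-∪ : (σ : Permutation′ n) (A B : Subset n) → actS σ (A ∪ B) ≡ actS σ A ∪ actS σ B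
  actS-∪ σ = actS-zipWith σ _

  actS-∁ : (σ : Permutation′ n) (A : Subset n) → actS σ (∁ A) ≡ ∁ (actS σ A)
  actS-∁ σ A = lookup-ext λ i → begin
    lookup (actS σ (∁ A)) i    ≡⟨ lookup-actS σ (∁ A) i ⟩
    lookup (∁ A) (σ ⟨$⟩ˡ i)    ≡⟨ Vec.lookup-map (σ ⟨$⟩ˡ i) not A ⟩
    not (lookup A (σ ⟨$⟩ˡ i))  ≡⟨ cong not (lookup-actS σ A i) ⟨
    not (lookup (actS σ A) i)  ≡⟨ Vec.lookup-map i not (actS σ A) ⟨
    lookup (∁ (actS σ A)) i    ∎
    where open ≡-Reasoning

  actS-─ : (σ : Permutation′ n) (A B : Subset n) → actS σ (A ─ B) ≡ actS σ A ─ actS σ B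
  actS-─ σ A B = begin
    actS σ (A ─ B)              ≡⟨ cong (actS σ) (p─q≡p∩∁q A B) ⟩
    actS σ (A ∩ ∁ B)            ≡⟨ actS-∩ σ A (∁ B) ⟩
    actS σ A ∩ actS σ (∁ B)     ≡⟨ cong (actS σ A ∩_) (actS-∁ σ B) ⟩
    actS σ A ∩ ∁ (actS σ B)     ≡⟨ p─q≡p∩∁q (actS σ A) (actS σ B) ⟨
    actS σ A ─ actS σ B         ∎
    where open ≡-Reasoning

  actS-⊥ : (σ : Permutation′ n) → actS σ ⊥ ≡ ⊥
  actS-⊥ σ = lookup-ext λ i →
    trans (lookup-actS σ ⊥ i) (trans (Vec.lookup-replicate (σ ⟨$⟩ˡ i) outside) (sym (Vec.lookup-replicate i outside)))

  actS-id : (A : Subset n) → actS Perm.id A ≡ A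
  actS-id = Vec.tabulate∘lookup

  actS-∘ : (π ρ : Permutation′ n) (A : Subset n) → actS (π ∘ₚ ρ) A ≡ actS ρ (actS π A)
  actS-∘ π ρ A = lookup-ext λ i →
    trans (lookup-actS (π ∘ₚ ρ) A i) (sym (trans (lookup-actS ρ (actS π A) i) (lookup-actS π A (ρ ⟨$⟩ˡ i))))

  actS-flip-actS : (σ : Permutation′ n) (A : Subset n) → actS (flip σ) (actS σ A) ≡ A
  actS-flip-actS σ A = lookup-ext λ i →
    trans (lookup-actS (flip σ) (actS σ A) i) (trans (lookup-actS σ A _) (cong (lookup A) (inverseˡ σ)))

  actS-actS-flip : (σ : Permutation′ n) (A : Subset n) → actS σ (actS (flip σ) A) ≡ A
  actS-actS-flip σ A = lookup-ext λ i →
    trans (lookup-actS σ (actS (flip σ) A) i) (trans (lookup-actS (flip σ) A _) (cong (lookup A) (inverseʳ σ)))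

  actS-injective : (σ : Permutation′ n) → actS σ A ≡ actS σ B → A ≡ B
  actS-injective {A = A} {B} σ σA≡σB =
    trans (sym (actS-flip-actS σ A)) (trans (cong (actS (flip σ)) σA≡σB) (actS-flip-actS σ B))

  actS-⊆ : (σ : Permutation′ n) → A ⊆ B → actS σ A ⊆ actS σ B
  actS-⊆ {A = A} {B} σ A⊆B {i} i∈σA = Vec.lookup⇒[]= i (actS σ B) (begin
    lookup (actS σ B) i   ≡⟨ lookup-actS σ B i ⟩
    lookup B (σ ⟨$⟩ˡ i)   ≡⟨ Vec.[]=⇒lookup (A⊆B σ⁻¹i∈A) ⟩
    inside                ∎)
    where
    open ≡-Reasoning
    σ⁻¹i∈A = Vec.lookup⇒[]= (σ ⟨$⟩ˡ i) A (trans (sym (lookup-actS σ A i)) (Vec.[]=⇒lookup i∈σA))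

  ∣p∣≡∑ : (A : Subset n) → ∣ A ∣ ≡ sum (λ i → if lookup A i then 1 else 0)
  ∣p∣≡∑ []            = refl
  ∣p∣≡∑ (inside  ∷ A) = cong suc (∣p∣≡∑ A)
  ∣p∣≡∑ (outside ∷ A) = ∣p∣≡∑ A

  ∣actS∣ : (σ : Permutation′ n) (A : Subset n) → ∣ actS σ A ∣ ≡ ∣ A ∣
  ∣actS∣ σ A = begin
    ∣ actS σ A ∣                                        ≡⟨ ∣p∣≡∑ (actS σ A) ⟩
    sum (λ i → if lookup (actS σ A) i then 1 else 0)    ≡⟨ sum-cong-≗ (λ i → cong (if_then 1 else 0) (lookup-actS σ A i)) ⟩
    sum (λ i → if lookup A (σ ⟨$⟩ˡ i) then 1 else 0)    ≡⟨ sum-permute (λ i → if lookup A i then 1 else 0) (flip σ) ⟨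
    sum (λ i → if lookup A i then 1 else 0)             ≡⟨ ∣p∣≡∑ A ⟨
    ∣ A ∣                                               ∎
    where open ≡-Reasoning

  subsetsOf-actS : (σ : Permutation′ n) (I : Subset n) → subsetsOf (actS σ I) ↭ map (actS σ) (subsetsOf I)
  subsetsOf-actS σ I = ∼bag⇒↭ (unique∧set⇒bag
    (subsetsOf-unique (actS σ I))
    (Unique.map⁺ (actS-injective σ) (subsetsOf-unique I))
    (mk⇔ to from))
    where
    to : ∀ {A} → A ∈ subsetsOf (actS σ I) → A ∈ map (actS σ) (subsetsOf I)
    to {A} A∈ = subst (_∈ map (actS σ) (subsetsOf I)) (actS-actS-flip σ A)
      (∈-map⁺ (actS σ) (∈-subsetsOf⁺ (subst (actS (flip σ) A ⊆_) (actS-flip-actS σ I)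
        (actS-⊆ (flip σ) (∈-subsetsOf⁻ (actS σ I) A∈)))))
    from : ∀ {A} → A ∈ map (actS σ) (subsetsOf I) → A ∈ subsetsOf (actS σ I)
    from A∈ with ∈-map⁻ (actS σ) A∈
    ... | B , B∈ , refl = ∈-subsetsOf⁺ (actS-⊆ σ (∈-subsetsOf⁻ I B∈))

  actW-id : (x : WSC n) → actW Perm.id x ≡ x
  actW-id x = trans (map-cong actS-id x) (map-id x)

  actW-∘ : (π ρ : Permutation′ n) (x : WSC n) → actW (π ∘ₚ ρ) x ≡ actW ρ (actW π x)
  actW-∘ π ρ x = trans (map-cong (actS-∘ π ρ) x) (map-∘ x)

  actW-injective : (σ : Permutation′ n) {x y : WSC n} → actW σ x ≡ actW σ y → x ≡ y
  actW-injective σ = map-injective (actS-injective σ)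

  actW-↾ : (σ : Permutation′ n) (x : WSC n) (S : Subset n) → actW σ x ↾ actS σ S ≡ actW σ (x ↾ S)
  actW-↾ σ x S = begin
    park (restrict (actW σ x) (actS σ S))          ≡⟨ park≡parkFrom (restrict (actW σ x) (actS σ S)) ⟩
    parkFrom 0 (restrict (actW σ x) (actS σ S))    ≡⟨ cong (parkFrom 0) restrict-actW ⟩
    parkFrom 0 (actW σ (restrict x S))             ≡⟨ parkFrom-map (actS σ) (∣actS∣ σ) 0 (restrict x S) ⟩
    actW σ (parkFrom 0 (restrict x S))             ≡⟨ cong (actW σ) (park≡parkFrom (restrict x S)) ⟨
    actW σ (park (restrict x S))                   ∎
    where
    open ≡-Reasoning
    restrict-actW : restrict (actW σ x) (actS σ S) ≡ actW σ (restrict x S)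
    restrict-actW = trans (sym (map-∘ x)) (trans (map-cong (λ A → sym (actS-∩ σ A S)) x) (map-∘ x))

  pairwiseDisjoint-actW : (σ : Permutation′ n) (Γ : WSC n) → PairwiseDisjoint Γ → PairwiseDisjoint (actW σ Γ)
  pairwiseDisjoint-actW σ []      _             = tt
  pairwiseDisjoint-actW σ (A ∷ Γ) (A⊥Γ , disjΓ) = σA⊥σΓ , pairwiseDisjoint-actW σ Γ disjΓ
    where
    σA⊥σΓ : ∀ B′ → B′ ∈ actW σ Γ → actS σ A ∩ B′ ≡ ⊥
    σA⊥σΓ B′ B′∈ with ∈-map⁻ (actS σ) B′∈
    ... | B , B∈ , refl = trans (sym (actS-∩ σ A B)) (trans (cong (actS σ) (A⊥Γ B B∈)) (actS-⊥ σ))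

  unionW-actW : (σ : Permutation′ n) (Γ : WSC n) → unionW (actW σ Γ) ≡ actS σ (unionW Γ)
  unionW-actW σ []      = sym (actS-⊥ σ)
  unionW-actW σ (A ∷ Γ) = trans (cong (actS σ A ∪_) (unionW-actW σ Γ)) (sym (actS-∪ σ A (unionW Γ)))

  size-actW : (σ : Permutation′ n) (Γ : WSC n) → size (actW σ Γ) ≡ size Γ
  size-actW σ []      = refl
  size-actW σ (A ∷ Γ) = cong₂ _+_ (∣actS∣ σ A) (size-actW σ Γ)

  pf-actW : (σ : Permutation′ n) {I : Subset n} {x : WSC n} → IsPF I x → IsPF (actS σ I) (actW σ x)
  pf-actW σ {I} {x} ((disjoint , union) , len , prefix) =
    (pairwiseDisjoint-actW σ x disjoint , trans (unionW-actW σ x) (cong (actS σ) union)) ,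
    trans (length-map (actS σ) x) (trans len (sym (∣actS∣ σ I))) ,
    λ k k≤ → subst (k ≤_) (sym (trans (cong size (take-map k x)) (size-actW σ (take k x))))
                   (prefix k (subst (k ≤_) (length-map (actS σ) x) k≤))


module ListSum {c ℓ} (R : CommutativeRing c ℓ) where

  open import Level using (Level)
  open import Data.List using (List; []; _∷_; _++_; map)
  open import Data.List.Membership.Propositional using (_∈_)
  open import Data.List.Relation.Unary.Any using (here; there)
  open import Data.List.Relation.Binary.Permutation.Propositional as Perm using (_↭_)
  open import Function using (_∘_)
  import Relation.Binary.PropositionalEquality as ≡

  open CommutativeRing R
  open import Algebra.Properties.CommutativeSemigroup +-commutativeSemigroup
    using () renaming (interchange to +-interchange; x∙yz≈y∙xz to x+[y+z]≈y+[x+z])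

  private variable
    a b : Level
    A B : Set a

  ∑ : List A → (A → Carrier) → Carrier
  ∑ []       f = 0#
  ∑ (x ∷ xs) f = f x + ∑ xs f

  syntax ∑ xs (λ x → e) = ∑[ x ← xs ] e

  ∑-cong : (xs : List A) {f g : A → Carrier} → (∀ x → f x ≈ g x) → ∑ xs f ≈ ∑ xs g
  ∑-cong []       f≈g = refl
  ∑-cong (x ∷ xs) f≈g = +-cong (f≈g x) (∑-cong xs f≈g)

  ∑-cong≡ : (xs : List A) {f g : A → Carrier} → (∀ x → f x ≡.≡ g x) → ∑ xs f ≡.≡ ∑ xs g
  ∑-cong≡ []       f≡g = ≡.refl
  ∑-cong≡ (x ∷ xs) f≡g = ≡.cong₂ _+_ (f≡g x) (∑-cong≡ xs f≡g)

  ∑-cong-∈ : (xs : List A) {f g : A → Carrier} → (∀ x → x ∈ xs → f x ≈ g x) → ∑ xs f ≈ ∑ xs g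
  ∑-cong-∈ []       f≈g = refl
  ∑-cong-∈ (x ∷ xs) f≈g = +-cong (f≈g x (here ≡.refl)) (∑-cong-∈ xs (λ y y∈ → f≈g y (there y∈)))

  ∑-zero : (xs : List A) {f : A → Carrier} → (∀ x → f x ≈ 0#) → ∑ xs f ≈ 0#
  ∑-zero []       f≈0 = refl
  ∑-zero (x ∷ xs) f≈0 = trans (+-cong (f≈0 x) (∑-zero xs f≈0)) (+-identityˡ 0#)

  ∑-+ : (xs : List A) (f g : A → Carrier) → ∑[ x ← xs ] (f x + g x) ≈ ∑ xs f + ∑ xs g
  ∑-+ []       f g = sym (+-identityˡ 0#)
  ∑-+ (x ∷ xs) f g = trans (+-congˡ (∑-+ xs f g)) (+-interchange (f x) (g x) (∑ xs f) (∑ xs g))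

  ∑-++ : (xs ys : List A) (f : A → Carrier) → ∑ (xs ++ ys) f ≈ ∑ xs f + ∑ ys f
  ∑-++ []       ys f = sym (+-identityˡ _)
  ∑-++ (x ∷ xs) ys f = trans (+-congˡ (∑-++ xs ys f)) (sym (+-assoc _ _ _))

  ∑-*ˡ : (a : Carrier) (xs : List A) (f : A → Carrier) → a * ∑ xs f ≈ ∑[ x ← xs ] (a * f x)
  ∑-*ˡ a []       f = zeroʳ a
  ∑-*ˡ a (x ∷ xs) f = trans (distribˡ a _ _) (+-congˡ (∑-*ˡ a xs f))

  ∑-*ʳ : (a : Carrier) (xs : List A) (f : A → Carrier) → ∑ xs f * a ≈ ∑[ x ← xs ] (f x * a)
  ∑-*ʳ a []       f = zeroˡ a
  ∑-*ʳ a (x ∷ xs) f = trans (distribʳ a _ _) (+-congˡ (∑-*ʳ a xs f))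

  ∑-↭ : {xs ys : List A} (f : A → Carrier) → xs ↭ ys → ∑ xs f ≈ ∑ ys f
  ∑-↭ f Perm.refl          = refl
  ∑-↭ f (Perm.prep x p)    = +-congˡ (∑-↭ f p)
  ∑-↭ f (Perm.swap x y p)  = trans (x+[y+z]≈y+[x+z] (f x) (f y) _) (+-congˡ (+-congˡ (∑-↭ f p)))
  ∑-↭ f (Perm.trans p q)   = trans (∑-↭ f p) (∑-↭ f q)

  ∑-map : (h : A → B) (xs : List A) (f : B → Carrier) → ∑ (map h xs) f ≡.≡ ∑ xs (f ∘ h)
  ∑-map h []       f = ≡.refl
  ∑-map h (x ∷ xs) f = ≡.cong (f (h x) +_) (∑-map h xs f)

  ∑-swap : (xs : List A) (ys : List B) (f : A → B → Carrier) →
           ∑[ x ← xs ] ∑ ys (f x) ≈ ∑[ y ← ys ] ∑[ x ← xs ] f x y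
  ∑-swap []       ys f = sym (∑-zero ys (λ _ → refl))
  ∑-swap (x ∷ xs) ys f = trans (+-congˡ (∑-swap xs ys f)) (sym (∑-+ ys (f x) (λ y → ∑[ x ← xs ] f x y)))


module SubsetSum {c ℓ} (R : CommutativeRing c ℓ) where

  open import Data.Nat using (ℕ; suc; _≡ᵇ_)
  open import Data.Bool using (true; false; if_then_else_)
  open import Data.Vec using ([]; _∷_)
  open import Data.Fin.Subset using (Subset; Side; inside; outside; ⊥; _─_; ∣_∣; _⊆_)
  open import Data.List using ([]; _∷_; _++_; map)
  open import Function using (_∘_)
  import Relation.Binary.PropositionalEquality as ≡
  open Subsets

  open CommutativeRing R
  open ListSum R
  open import Relation.Binary.Reasoning.Setoid setoid

  private variable
    n : ℕ

  ∑⊆ : Subset n → (Subset n → Carrier) → Carrier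
  ∑⊆ I = ∑ (subsetsOf I)

  syntax ∑⊆ I (λ S → e) = ∑[ S ⊆ I ] e

  ∑⊆-outside : (I : Subset n) (g : Subset (suc n) → Carrier) → ∑⊆ (outside ∷ I) g ≡.≡ ∑[ S ⊆ I ] g (outside ∷ S)
  ∑⊆-outside I g = ∑-map (outside ∷_) (subsetsOf I) g

  ∑⊆-inside : (I : Subset n) (g : Subset (suc n) → Carrier) →
              ∑⊆ (inside ∷ I) g ≈ ∑[ S ⊆ I ] g (outside ∷ S) + ∑[ S ⊆ I ] g (inside ∷ S)
  ∑⊆-inside I g = trans (∑-++ (map (outside ∷_) (subsetsOf I)) _ g)
    (reflexive (≡.cong₂ _+_ (∑-map (outside ∷_) (subsetsOf I) g) (∑-map (inside ∷_) (subsetsOf I) g)))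

  ∑⊆-cong : (I : Subset n) {g h : Subset n → Carrier} → (∀ S → S ⊆ I → g S ≈ h S) → ∑⊆ I g ≈ ∑⊆ I h
  ∑⊆-cong I g≈h = ∑-cong-∈ (subsetsOf I) (λ S S∈ → g≈h S (∈-subsetsOf⁻ I S∈))

  ∑⊆-empty : (I : Subset n) (g : Subset n → Carrier) → ∑[ S ⊆ I ] (if ∣ S ∣ ≡ᵇ 0 then g S else 0#) ≈ g ⊥
  ∑⊆-empty []            g = +-identityʳ _
  ∑⊆-empty (outside ∷ I) g = ≡.subst (_≈ g ⊥) (≡.sym (∑⊆-outside I _)) (∑⊆-empty I (g ∘ (outside ∷_)))
  ∑⊆-empty (inside ∷ I)  g = trans (∑⊆-inside I _)
    (trans (+-cong (∑⊆-empty I (g ∘ (outside ∷_))) (∑-zero (subsetsOf I) (λ _ → refl))) (+-identityʳ _))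

  ∑⊆-full : (I : Subset n) (g : Subset n → Carrier) → ∑[ S ⊆ I ] (if ∣ I ─ S ∣ ≡ᵇ 0 then g S else 0#) ≈ g I
  ∑⊆-full []            g = +-identityʳ _
  ∑⊆-full (outside ∷ I) g = ≡.subst (_≈ g (outside ∷ I)) (≡.sym (∑⊆-outside I _)) (∑⊆-full I (g ∘ (outside ∷_)))
  ∑⊆-full (inside ∷ I)  g = trans (∑⊆-inside I _)
    (trans (+-cong (∑-zero (subsetsOf I) (λ _ → refl)) (∑⊆-full I (g ∘ (inside ∷_)))) (+-identityˡ _))

  ∑⊆-split-empty : (I : Subset n) (g : Subset n → Carrier) →
                   ∑⊆ I g ≈ g ⊥ + ∑[ S ⊆ I ] (if ∣ S ∣ ≡ᵇ 0 then 0# else g S)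
  ∑⊆-split-empty I g = begin
    ∑⊆ I g
      ≈⟨ ∑-cong (subsetsOf I) (λ S → split (∣ S ∣ ≡ᵇ 0) (g S)) ⟩
    ∑[ S ⊆ I ] ((if ∣ S ∣ ≡ᵇ 0 then g S else 0#) + (if ∣ S ∣ ≡ᵇ 0 then 0# else g S))
      ≈⟨ ∑-+ (subsetsOf I) _ _ ⟩
    ∑[ S ⊆ I ] (if ∣ S ∣ ≡ᵇ 0 then g S else 0#) + ∑[ S ⊆ I ] (if ∣ S ∣ ≡ᵇ 0 then 0# else g S)
      ≈⟨ +-congʳ (∑⊆-empty I g) ⟩
    g ⊥ + ∑[ S ⊆ I ] (if ∣ S ∣ ≡ᵇ 0 then 0# else g S) ∎
    where
    split : ∀ β a → a ≈ (if β then a else 0#) + (if β then 0# else a)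
    split true  a = sym (+-identityʳ a)
    split false a = sym (+-identityˡ a)

  Summand₃ : ℕ → Set c
  Summand₃ n = Subset n → Subset n → Subset n → Carrier

  ∑₃ : Subset n → Summand₃ n → Carrier
  ∑₃ I G = ∑[ S ⊆ I ] ∑[ T ⊆ I ─ S ] G S T (I ─ S ─ T)

  rotate : Summand₃ n → Summand₃ n
  rotate G U S T = G S T U

  headed : Side → Side → Side → Summand₃ (suc n) → Summand₃ n
  headed a b c G S T R = G (a ∷ S) (b ∷ T) (c ∷ R)

  ∑₃-outside : (I : Subset n) (G : Summand₃ (suc n)) → ∑₃ (outside ∷ I) G ≈ ∑₃ I (headed outside outside outside G)
  ∑₃-outside I G = reflexive (≡.trans (∑⊆-outside I _) (∑-cong≡ (subsetsOf I) (λ S → ∑⊆-outside (I ─ S) _)))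

  ∑₃-inside : (I : Subset n) (G : Summand₃ (suc n)) →
              ∑₃ (inside ∷ I) G ≈ (∑₃ I (headed outside outside inside G) + ∑₃ I (headed outside inside outside G))
                                  + ∑₃ I (headed inside outside outside G)
  ∑₃-inside I G = begin
    ∑₃ (inside ∷ I) G
      ≈⟨ ∑⊆-inside I _ ⟩
    ∑[ S ⊆ I ] ∑[ T ⊆ inside ∷ (I ─ S) ] G (outside ∷ S) T ((inside ∷ (I ─ S)) ─ T)
      + ∑[ S ⊆ I ] ∑[ T ⊆ outside ∷ (I ─ S) ] G (inside ∷ S) T ((outside ∷ (I ─ S)) ─ T)
      ≈⟨ +-cong (∑-cong (subsetsOf I) (λ S → ∑⊆-inside (I ─ S) _))
                (reflexive (∑-cong≡ (subsetsOf I) (λ S → ∑⊆-outside (I ─ S) _))) ⟩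
    ∑[ S ⊆ I ] (∑[ T ⊆ I ─ S ] headed outside outside inside G S T (I ─ S ─ T)
              + ∑[ T ⊆ I ─ S ] headed outside inside outside G S T (I ─ S ─ T))
      + ∑₃ I (headed inside outside outside G)
      ≈⟨ +-congʳ (∑-+ (subsetsOf I) _ _) ⟩
    (∑₃ I (headed outside outside inside G) + ∑₃ I (headed outside inside outside G))
      + ∑₃ I (headed inside outside outside G) ∎

  ∑₃-rotate : (I : Subset n) (G : Summand₃ n) → ∑₃ I G ≈ ∑₃ I (rotate G)
  ∑₃-rotate []            G = refl
  ∑₃-rotate (outside ∷ I) G = trans (∑₃-outside I G)
    (trans (∑₃-rotate I (headed outside outside outside G)) (sym (∑₃-outside I (rotate G))))
  ∑₃-rotate (inside ∷ I)  G = begin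
    ∑₃ (inside ∷ I) G
      ≈⟨ ∑₃-inside I G ⟩
    (∑₃ I G₃ + ∑₃ I G₂) + ∑₃ I G₁
      ≈⟨ +-cong (+-cong (∑₃-rotate I G₃) (∑₃-rotate I G₂)) (∑₃-rotate I G₁) ⟩
    (∑₃ I (rotate G₃) + ∑₃ I (rotate G₂)) + ∑₃ I (rotate G₁)
      ≈⟨ trans (+-assoc _ _ _) (+-comm _ _) ⟩
    (∑₃ I (rotate G₂) + ∑₃ I (rotate G₁)) + ∑₃ I (rotate G₃)
      ≈⟨ ∑₃-inside I (rotate G) ⟨
    ∑₃ (inside ∷ I) (rotate G) ∎
    where
    G₁ G₂ G₃ : Summand₃ _
    G₁ = headed inside outside outside G
    G₂ = headed outside inside outside G
    G₃ = headed outside outside inside G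


module Coefficients {c ℓ} (K : Field c ℓ) where

  open import Data.Nat using (ℕ)
  open import Data.Bool using (true; false; if_then_else_)
  open import Data.List using (List; []; _∷_; _++_; map; concatMap)
  open import Data.List.Relation.Binary.Permutation.Propositional using (_↭_)
  open import Data.List.Relation.Unary.All using (All; []; _∷_)
  open import Data.Product using (_×_; _,_; proj₂; map₁; map₂)
  open import Function using (_∘_)
  open import Function.Definitions using (Injective)
  open import Relation.Nullary using (¬_; Dec; does; yes; no; contradiction)
  open import Relation.Nullary.Decidable using (dec-true; dec-false)
  import Relation.Binary.PropositionalEquality as ≡
  open ≡ using (_≡_)

  open Field K
  open ListSum commutativeRing
  open import Algebra.Properties.AbelianGroup +-abelianGroup
    using () renaming (ε⁻¹≈ε to -0#≈0#; ⁻¹-∙-comm to -‿+-comm)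

  private variable
    n : ℕ

  Lin : ℕ → Set c
  Lin = LC K {WSC} _≟W_

  ⟦_⟧ : Lin n → WSC n → Carrier
  ⟦_⟧ = coeff K {WSC} _≟W_

  term : Carrier × WSC n → WSC n → Carrier
  term (a , v) w = if does (v ≟W w) then a else 0#

  ⟦⟧≡∑term : (l : Lin n) (w : WSC n) → ⟦ l ⟧ w ≡ ∑[ t ← l ] term t w
  ⟦⟧≡∑term []      w = ≡.refl
  ⟦⟧≡∑term (t ∷ l) w = ≡.cong (term t w +_) (⟦⟧≡∑term l w)

  term-≡ : ∀ {v w : WSC n} a → v ≡ w → term (a , v) w ≡ a
  term-≡ {v = v} {w} a v≡w rewrite dec-true (v ≟W w) v≡w = ≡.refl

  term-≢ : ∀ {v w : WSC n} a → ¬ v ≡ w → term (a , v) w ≡ 0#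
  term-≢ {v = v} {w} a v≢w rewrite dec-false (v ≟W w) v≢w = ≡.refl

  ⟦⟧-++ : (l m : Lin n) (w : WSC n) → ⟦ l ++ m ⟧ w ≈ ⟦ l ⟧ w + ⟦ m ⟧ w
  ⟦⟧-++ []      m w = sym (+-identityˡ _)
  ⟦⟧-++ (t ∷ l) m w = trans (+-congˡ (⟦⟧-++ l m w)) (sym (+-assoc _ _ _))

  ⟦⟧-concatMap : ∀ {a} {A : Set a} (f : A → Lin n) (xs : List A) (w : WSC n) →
                 ⟦ concatMap f xs ⟧ w ≈ ∑[ x ← xs ] ⟦ f x ⟧ w
  ⟦⟧-concatMap f []       w = refl
  ⟦⟧-concatMap f (x ∷ xs) w = trans (⟦⟧-++ (f x) (concatMap f xs) w) (+-congˡ (⟦⟧-concatMap f xs w))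

  ⟦⟧-↭ : {l m : Lin n} → l ↭ m → ∀ w → ⟦ l ⟧ w ≈ ⟦ m ⟧ w
  ⟦⟧-↭ {l = l} {m} l↭m w =
    ≡.subst₂ _≈_ (≡.sym (⟦⟧≡∑term l w)) (≡.sym (⟦⟧≡∑term m w)) (∑-↭ (λ t → term t w) l↭m)

  neg : Lin n → Lin n
  neg = map (map₁ (-_))

  ⟦⟧-neg : (l : Lin n) (w : WSC n) → ⟦ neg l ⟧ w ≈ - ⟦ l ⟧ w
  ⟦⟧-neg []            w = sym -0#≈0#
  ⟦⟧-neg ((a , v) ∷ l) w = trans (+-cong (term-neg (does (v ≟W w))) (⟦⟧-neg l w)) (-‿+-comm _ _)
    where
    term-neg : ∀ b → (if b then - a else 0#) ≈ - (if b then a else 0#)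
    term-neg true  = refl
    term-neg false = sym -0#≈0#

  ⟦⟧-map-injective : (g : WSC n → WSC n) → Injective _≡_ _≡_ g → (l : Lin n) (w : WSC n) →
                     ⟦ map (map₂ g) l ⟧ (g w) ≈ ⟦ l ⟧ w
  ⟦⟧-map-injective g g-inj []            w = refl
  ⟦⟧-map-injective g g-inj ((a , v) ∷ l) w = +-cong (reflexive (same-term (v ≟W w))) (⟦⟧-map-injective g g-inj l w)
    where
    same-term : Dec (v ≡ w) → term (a , g v) (g w) ≡ term (a , v) w
    same-term (yes v≡w) = ≡.trans (term-≡ a (≡.cong g v≡w)) (≡.sym (term-≡ a v≡w))
    same-term (no v≢w)  = ≡.trans (term-≢ a (v≢w ∘ g-inj)) (≡.sym (term-≢ a v≢w))

  ⟦⟧-support : ∀ {p} (P : WSC n → Set p) (l : Lin n) {w : WSC n} → All (P ∘ proj₂) l → ¬ ⟦ l ⟧ w ≈ 0# → P w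
  ⟦⟧-support P []            []           ⟦l⟧w≉0 = contradiction refl ⟦l⟧w≉0
  ⟦⟧-support P ((a , v) ∷ l) {w} (Pv ∷ Pl) ⟦l⟧w≉0 with v ≟W w
  ... | yes v≡w = ≡.subst P v≡w Pv
  ... | no  _   = ⟦⟧-support P l Pl (λ ⟦l⟧w≈0 → ⟦l⟧w≉0 (trans (+-identityˡ _) ⟦l⟧w≈0))


module ConcatenationProduct {c ℓ} (K : Field c ℓ) where

  open import Data.Nat using (ℕ)
  open import Data.Bool using (true; false; if_then_else_)
  open import Data.Fin.Subset using (Subset)
  open import Data.List using (List; []; _∷_; _++_; map; concatMap)
  import Data.List.Properties as List
  open import Data.Product using (_×_; _,_; proj₁; proj₂; map₁; map₂)
  open import Relation.Nullary using (does)
  import Relation.Binary.PropositionalEquality as ≡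
  open ≡ using (_≡_)
  import Data.Vec.Properties as Vec
  import Data.Bool.Properties as Bool

  open Field K
  open ListSum commutativeRing
  open Coefficients K
  open import Relation.Binary.Reasoning.Setoid setoid

  private variable
    n : ℕ

  term-cong : ∀ (w : WSC n) {a b} v → a ≈ b → term (a , v) w ≈ term (b , v) w
  term-cong w v a≈b with does (v ≟W w)
  ... | true  = a≈b
  ... | false = refl

  term-* : ∀ (w : WSC n) a b v → term (a * b , v) w ≈ a * term (b , v) w
  term-* w a b v with does (v ≟W w)
  ... | true  = refl
  ... | false = sym (zeroʳ a)

  term-∷ : ∀ (a : Carrier) (C D : Subset n) (u w : WSC n) →
           term (a , D ∷ u) (C ∷ w) ≡ (if does (Vec.≡-dec Bool._≟_ D C) then term (a , u) w else 0#)
  term-∷ a C D u w with does (Vec.≡-dec Bool._≟_ D C)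
  ... | true  = ≡.refl
  ... | false = ≡.refl

  _·ₜ_ : Carrier × WSC n → Carrier × WSC n → Carrier × WSC n
  (a , u) ·ₜ (b , v) = (a * b , u ++ v)

  _⊛_ : Lin n → Lin n → Lin n
  l ⊛ m = concatMap (λ t → map (t ·ₜ_) m) l

  splits : WSC n → List (WSC n × WSC n)
  splits []      = ([] , []) ∷ []
  splits (C ∷ w) = ([] , C ∷ w) ∷ map (map₁ (C ∷_)) (splits w)

  _⋆_ : (WSC n → Carrier) → (WSC n → Carrier) → WSC n → Carrier
  (f ⋆ g) w = ∑[ s ← splits w ] (f (proj₁ s) * g (proj₂ s))

  term-·ₜ : ∀ a b (u v w : WSC n) → term ((a , u) ·ₜ (b , v)) w ≈ (term (a , u) ⋆ term (b , v)) w
  term-·ₜ a b [] v [] = trans (term-* [] a b v) (sym (+-identityʳ _))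
  term-·ₜ a b [] v (C ∷ w) = trans (term-* (C ∷ w) a b v) (sym (trans (+-congˡ rest≈0) (+-identityʳ _)))
    where
    rest≈0 : ∑ (map (map₁ (C ∷_)) (splits w)) (λ s → term (a , []) (proj₁ s) * term (b , v) (proj₂ s)) ≈ 0#
    rest≈0 = ≡.subst (_≈ 0#) (≡.sym (∑-map _ (splits w) _)) (∑-zero (splits w) (λ _ → zeroˡ _))
  term-·ₜ a b (D ∷ u) v [] = sym (trans (+-identityʳ _) (zeroˡ _))
  term-·ₜ a b (D ∷ u) v (C ∷ w) = begin
    term (a * b , D ∷ (u ++ v)) (C ∷ w)
      ≡⟨ term-∷ (a * b) C D (u ++ v) w ⟩
    (if D≟C then term (a * b , u ++ v) w else 0#)
      ≈⟨ matching-heads D≟C ⟩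
    ∑[ s ← splits w ] ((if D≟C then term (a , u) (proj₁ s) else 0#) * term (b , v) (proj₂ s))
      ≈⟨ ∑-cong (splits w) (λ s → reflexive (≡.cong (_* term (b , v) (proj₂ s)) (term-∷ a C D u (proj₁ s)))) ⟨
    ∑[ s ← splits w ] (term (a , D ∷ u) (C ∷ proj₁ s) * term (b , v) (proj₂ s))
      ≡⟨ ∑-map (map₁ (C ∷_)) (splits w) _ ⟨
    ∑ (map (map₁ (C ∷_)) (splits w)) (λ s → term (a , D ∷ u) (proj₁ s) * term (b , v) (proj₂ s))
      ≈⟨ trans (+-congʳ (zeroˡ _)) (+-identityˡ _) ⟨
    (term (a , D ∷ u) ⋆ term (b , v)) (C ∷ w) ∎
    where
    D≟C = does (Vec.≡-dec Bool._≟_ D C)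
    matching-heads : ∀ β → (if β then term (a * b , u ++ v) w else 0#) ≈
                     ∑[ s ← splits w ] ((if β then term (a , u) (proj₁ s) else 0#) * term (b , v) (proj₂ s))
    matching-heads true  = term-·ₜ a b u v w
    matching-heads false = sym (∑-zero (splits w) (λ _ → zeroˡ _))

  ⟦⊛⟧ : (l m : Lin n) (w : WSC n) → ⟦ l ⊛ m ⟧ w ≈ (⟦ l ⟧ ⋆ ⟦ m ⟧) w
  ⟦⊛⟧ l m w = begin
    ⟦ l ⊛ m ⟧ w
      ≈⟨ ⟦⟧-concatMap (λ t → map (t ·ₜ_) m) l w ⟩
    ∑[ t ← l ] ⟦ map (t ·ₜ_) m ⟧ w
      ≡⟨ ∑-cong≡ l (λ t → ≡.trans (⟦⟧≡∑term (map (t ·ₜ_) m) w) (∑-map (t ·ₜ_) m (λ t′ → term t′ w))) ⟩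
    ∑[ t ← l ] ∑[ t′ ← m ] term (t ·ₜ t′) w
      ≈⟨ ∑-cong l (λ t → ∑-cong m (λ t′ → term-·ₜ (proj₁ t) (proj₁ t′) (proj₂ t) (proj₂ t′) w)) ⟩
    ∑[ t ← l ] ∑[ t′ ← m ] ∑[ s ← S ] (term t (proj₁ s) * term t′ (proj₂ s))
      ≈⟨ ∑-cong l (λ t → ∑-swap m S _) ⟩
    ∑[ t ← l ] ∑[ s ← S ] ∑[ t′ ← m ] (term t (proj₁ s) * term t′ (proj₂ s))
      ≈⟨ ∑-swap l S _ ⟩
    ∑[ s ← S ] ∑[ t ← l ] ∑[ t′ ← m ] (term t (proj₁ s) * term t′ (proj₂ s))
      ≈⟨ ∑-cong S (λ s → ∑-cong l (λ t → ∑-*ˡ (term t (proj₁ s)) m (λ t′ → term t′ (proj₂ s)))) ⟨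
    ∑[ s ← S ] ∑[ t ← l ] (term t (proj₁ s) * ∑[ t′ ← m ] term t′ (proj₂ s))
      ≈⟨ ∑-cong S (λ s → ∑-*ʳ _ l (λ t → term t (proj₁ s))) ⟨
    ∑[ s ← S ] (∑[ t ← l ] term t (proj₁ s) * ∑[ t′ ← m ] term t′ (proj₂ s))
      ≈⟨ ∑-cong S (λ s → reflexive (≡.cong₂ _*_ (⟦⟧≡∑term l (proj₁ s)) (⟦⟧≡∑term m (proj₂ s)))) ⟨
    (⟦ l ⟧ ⋆ ⟦ m ⟧) w ∎
    where
    S = splits w

  ⊛-congˡ : {l l′ : Lin n} (m : Lin n) → (∀ v → ⟦ l ⟧ v ≈ ⟦ l′ ⟧ v) →
            ∀ w → ⟦ l ⊛ m ⟧ w ≈ ⟦ l′ ⊛ m ⟧ w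
  ⊛-congˡ {l = l} {l′} m l≈l′ w =
    trans (⟦⊛⟧ l m w) (trans (∑-cong (splits w) (λ s → *-congʳ (l≈l′ (proj₁ s)))) (sym (⟦⊛⟧ l′ m w)))

  ⊛-congʳ : (l : Lin n) {m m′ : Lin n} → (∀ v → ⟦ m ⟧ v ≈ ⟦ m′ ⟧ v) →
            ∀ w → ⟦ l ⊛ m ⟧ w ≈ ⟦ l ⊛ m′ ⟧ w
  ⊛-congʳ l {m} {m′} m≈m′ w =
    trans (⟦⊛⟧ l m w) (trans (∑-cong (splits w) (λ s → *-congˡ (m≈m′ (proj₂ s)))) (sym (⟦⊛⟧ l m′ w)))

  ⊛-concatMapˡ : ∀ {a} {A : Set a} (f : A → Lin n) (xs : List A) (m : Lin n) (w : WSC n) →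
                 ⟦ concatMap f xs ⊛ m ⟧ w ≈ ∑[ x ← xs ] ⟦ f x ⊛ m ⟧ w
  ⊛-concatMapˡ f xs m w = begin
    ⟦ concatMap f xs ⊛ m ⟧ w
      ≈⟨ ⟦⊛⟧ (concatMap f xs) m w ⟩
    ∑[ s ← S ] (⟦ concatMap f xs ⟧ (proj₁ s) * ⟦ m ⟧ (proj₂ s))
      ≈⟨ ∑-cong S (λ s → *-congʳ (⟦⟧-concatMap f xs (proj₁ s))) ⟩
    ∑[ s ← S ] (∑[ x ← xs ] ⟦ f x ⟧ (proj₁ s) * ⟦ m ⟧ (proj₂ s))
      ≈⟨ ∑-cong S (λ s → ∑-*ʳ _ xs _) ⟩
    ∑[ s ← S ] ∑[ x ← xs ] (⟦ f x ⟧ (proj₁ s) * ⟦ m ⟧ (proj₂ s))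
      ≈⟨ ∑-swap S xs _ ⟩
    ∑[ x ← xs ] (⟦ f x ⟧ ⋆ ⟦ m ⟧) w
      ≈⟨ ∑-cong xs (λ x → ⟦⊛⟧ (f x) m w) ⟨
    ∑[ x ← xs ] ⟦ f x ⊛ m ⟧ w ∎
    where
    S = splits w

  ⊛-concatMapʳ : ∀ {a} {A : Set a} (l : Lin n) (f : A → Lin n) (xs : List A) (w : WSC n) →
                 ⟦ l ⊛ concatMap f xs ⟧ w ≈ ∑[ x ← xs ] ⟦ l ⊛ f x ⟧ w
  ⊛-concatMapʳ l f xs w = begin
    ⟦ l ⊛ concatMap f xs ⟧ w
      ≈⟨ ⟦⊛⟧ l (concatMap f xs) w ⟩
    ∑[ s ← S ] (⟦ l ⟧ (proj₁ s) * ⟦ concatMap f xs ⟧ (proj₂ s))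
      ≈⟨ ∑-cong S (λ s → *-congˡ (⟦⟧-concatMap f xs (proj₂ s))) ⟩
    ∑[ s ← S ] (⟦ l ⟧ (proj₁ s) * ∑[ x ← xs ] ⟦ f x ⟧ (proj₂ s))
      ≈⟨ ∑-cong S (λ s → ∑-*ˡ _ xs _) ⟩
    ∑[ s ← S ] ∑[ x ← xs ] (⟦ l ⟧ (proj₁ s) * ⟦ f x ⟧ (proj₂ s))
      ≈⟨ ∑-swap S xs _ ⟩
    ∑[ x ← xs ] (⟦ l ⟧ ⋆ ⟦ f x ⟧) w
      ≈⟨ ∑-cong xs (λ x → ⟦⊛⟧ l (f x) w) ⟨
    ∑[ x ← xs ] ⟦ l ⊛ f x ⟧ w ∎
    where
    S = splits w

  one : Lin n
  one = (1# , []) ∷ []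

  ⊛-identityʳ : (l : Lin n) (w : WSC n) → ⟦ l ⊛ one ⟧ w ≈ ⟦ l ⟧ w
  ⊛-identityʳ []            w = refl
  ⊛-identityʳ ((a , u) ∷ l) w rewrite List.++-identityʳ u = +-cong (term-cong w u (*-identityʳ a)) (⊛-identityʳ l w)

  ⊛-identityˡ : (m : Lin n) (w : WSC n) → ⟦ one ⊛ m ⟧ w ≈ ⟦ m ⟧ w
  ⊛-identityˡ m w = begin
    ⟦ map ((1# , []) ·ₜ_) m ++ [] ⟧ w ≡⟨ ≡.cong (λ l → ⟦ l ⟧ w) (List.++-identityʳ (map ((1# , []) ·ₜ_) m)) ⟩
    ⟦ map ((1# , []) ·ₜ_) m ⟧ w       ≈⟨ unit-terms m ⟩
    ⟦ m ⟧ w                           ∎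
    where
    unit-terms : (m : Lin _) → ⟦ map ((1# , []) ·ₜ_) m ⟧ w ≈ ⟦ m ⟧ w
    unit-terms []            = refl
    unit-terms ((b , v) ∷ m) = +-cong (term-cong w v (*-identityˡ b)) (unit-terms m)

  ⊛-zeroʳ : (l : Lin n) → l ⊛ [] ≡ []
  ⊛-zeroʳ []      = ≡.refl
  ⊛-zeroʳ (t ∷ l) = ⊛-zeroʳ l

  _◃_ : WSC n → Lin n → Lin n
  y ◃ l = map (map₂ (y ++_)) l

  _▹_ : Lin n → WSC n → Lin n
  l ▹ y = map (map₂ (_++ y)) l

  ⊛-◃ : (l m : Lin n) (y : WSC n) → l ⊛ (y ◃ m) ≡ (l ▹ y) ⊛ m
  ⊛-◃ l m y = ≡.trans
    (List.concatMap-cong (λ t → ≡.trans (≡.sym (List.map-∘ m))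
       (List.map-cong (λ t′ → ≡.cong (proj₁ t * proj₁ t′ ,_) (≡.sym (List.++-assoc (proj₂ t) y (proj₂ t′)))) m)) l)
    (≡.sym (List.concatMap-map _ (map₂ (_++ y)) l))


module Antipode {c ℓ} (K : Field c ℓ) where

  open import Data.Nat using (ℕ; zero; suc; _≤_; _<_; _≡ᵇ_)
  import Data.Nat.Properties as ℕ
  open import Data.Bool using (true; false; if_then_else_)
  import Data.Bool as Bool
  open import Data.Fin.Subset using (Subset; ⊥; _─_; ∣_∣; _⊆_)
  open import Data.Fin.Subset.Properties using (p─⊥≡p; p⊆q⇒∣p∣≤∣q∣; ∣⊥∣≡0)
  open import Data.List using (List; []; _∷_; concatMap; concat)
  import Data.List.Properties as List
  open import Data.List.Relation.Unary.All using (All; []; _∷_)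
  import Data.List.Relation.Unary.All as All
  import Data.List.Relation.Unary.All.Properties as All
  open import Relation.Nullary using (¬_; contradiction)
  open import Data.Product using (proj₂)
  open import Function using (_∘_)
  import Relation.Binary.PropositionalEquality as ≡
  open ≡ using (_≡_)
  open Subsets
  open ParkingFunctions

  open Field K hiding (zero)
  open ListSum commutativeRing
  open SubsetSum commutativeRing
  open Coefficients K
  open ConcatenationProduct K
  open import Relation.Binary.Reasoning.Setoid setoid

  private variable
    n : ℕ

  ιε : Subset n → Lin n
  ιε I = if ∣ I ∣ ≡ᵇ 0 then one else []

  -- Takeuchi's recursion s_I(x) = − Σ_{∅ ≠ S ⊆ I} x↾S · s_{I∖S}(x↾(I∖S)); as |I ∖ S| < |I|,
  -- the fuel |I| is always enough (antipodeWithFuel≡antipode).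
  antipodeWithFuel : ℕ → Subset n → WSC n → Lin n
  antipodeWithFuel zero    I x = one
  antipodeWithFuel (suc k) I x = if ∣ I ∣ ≡ᵇ 0 then one else
    neg (concatMap (λ S → if ∣ S ∣ ≡ᵇ 0 then [] else (x ↾ S) ◃ antipodeWithFuel k (I ─ S) (x ↾ (I ─ S))) (subsetsOf I))

  antipode : Subset n → WSC n → Lin n
  antipode I x = antipodeWithFuel ∣ I ∣ I x

  concatMap-subsetsOf-cong : ∀ {a} {A : Set a} (I : Subset n) {f g : Subset n → List A} →
                             (∀ S → S ⊆ I → f S ≡ g S) → concatMap f (subsetsOf I) ≡ concatMap g (subsetsOf I)
  concatMap-subsetsOf-cong I f≡g = ≡.cong concat (List.map-cong-local (All.tabulate λ {S} S∈ → f≡g S (∈-subsetsOf⁻ I S∈)))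

  antipodeWithFuel-cong : ∀ k k′ (I : Subset n) (x : WSC n) → ∣ I ∣ ≤ k → ∣ I ∣ ≤ k′ →
                          antipodeWithFuel k I x ≡ antipodeWithFuel k′ I x
  antipodeWithFuel-cong zero    zero     I x _      _       = ≡.refl
  antipodeWithFuel-cong zero    (suc k′) I x ∣I∣≤0 _       rewrite ℕ.n≤0⇒n≡0 ∣I∣≤0 = ≡.refl
  antipodeWithFuel-cong (suc k) zero     I x _      ∣I∣≤0  rewrite ℕ.n≤0⇒n≡0 ∣I∣≤0 = ≡.refl
  antipodeWithFuel-cong (suc k) (suc k′) I x ∣I∣≤k ∣I∣≤k′ with ∣ I ∣ ≡ᵇ 0
  ... | true  = ≡.refl
  ... | false = ≡.cong neg (concatMap-subsetsOf-cong I summand)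
    where
    summand : ∀ S → S ⊆ I →
      (if ∣ S ∣ ≡ᵇ 0 then [] else (x ↾ S) ◃ antipodeWithFuel k (I ─ S) (x ↾ (I ─ S))) ≡
      (if ∣ S ∣ ≡ᵇ 0 then [] else (x ↾ S) ◃ antipodeWithFuel k′ (I ─ S) (x ↾ (I ─ S)))
    summand S S⊆I with ∣ S ∣ in eq
    ... | zero  = ≡.refl
    ... | suc m =
      ≡.cong ((x ↾ S) ◃_) (antipodeWithFuel-cong k k′ (I ─ S) (x ↾ (I ─ S)) (smaller ∣I∣≤k) (smaller ∣I∣≤k′))
      where
      smaller : ∀ {j} → ∣ I ∣ ≤ suc j → ∣ I ─ S ∣ ≤ j
      smaller ∣I∣≤1+j = ℕ.≤-pred (ℕ.≤-trans (p⊆q⇒∣q─p∣<∣q∣ S⊆I eq) ∣I∣≤1+j)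

  antipodeWithFuel≡antipode : ∀ k (I : Subset n) (x : WSC n) → ∣ I ∣ ≤ k → antipodeWithFuel k I x ≡ antipode I x
  antipodeWithFuel≡antipode k I x ∣I∣≤k = antipodeWithFuel-cong k ∣ I ∣ I x ∣I∣≤k ℕ.≤-refl

  antipode-empty : (I : Subset n) (x : WSC n) → ∣ I ∣ ≡ 0 → antipode I x ≡ one
  antipode-empty I x ∣I∣≡0 rewrite ∣I∣≡0 = ≡.refl

  antipode-recursion : (I : Subset n) (x w : WSC n) →
    ⟦ antipode I x ⟧ w + ∑[ S ⊆ I ] (if ∣ S ∣ ≡ᵇ 0 then 0# else ⟦ (x ↾ S) ◃ antipode (I ─ S) (x ↾ (I ─ S)) ⟧ w)
      ≈ ⟦ ιε I ⟧ w
  antipode-recursion I x w with ∣ I ∣ in eq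
  ... | zero  = trans (+-congˡ (trans (∑⊆-cong I no-nonempty) (∑-zero (subsetsOf I) (λ _ → refl)))) (+-identityʳ _)
    where
    no-nonempty : ∀ S → S ⊆ I →
                  (if ∣ S ∣ ≡ᵇ 0 then 0# else ⟦ (x ↾ S) ◃ antipode (I ─ S) (x ↾ (I ─ S)) ⟧ w) ≈ 0#
    no-nonempty S S⊆I rewrite ℕ.n≤0⇒n≡0 (≡.subst (∣ S ∣ ≤_) eq (p⊆q⇒∣p∣≤∣q∣ S⊆I)) = refl
  ... | suc k rewrite eq = begin
    ⟦ neg (concatMap F (subsetsOf I)) ⟧ w + ∑⊆ I nonemptyTerm  ≈⟨ +-congʳ (⟦⟧-neg (concatMap F (subsetsOf I)) w) ⟩
    - ⟦ concatMap F (subsetsOf I) ⟧ w + ∑⊆ I nonemptyTerm      ≈⟨ +-congʳ (-‿cong (⟦⟧-concatMap F (subsetsOf I) w)) ⟩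
    - ∑[ S ⊆ I ] ⟦ F S ⟧ w + ∑⊆ I nonemptyTerm                 ≈⟨ +-congʳ (-‿cong (∑⊆-cong I F≈nonemptyTerm)) ⟩
    - ∑⊆ I nonemptyTerm + ∑⊆ I nonemptyTerm                              ≈⟨ -‿inverseˡ _ ⟩
    0#                                               ∎
    where
    F : Subset _ → Lin _
    F S = if ∣ S ∣ ≡ᵇ 0 then [] else (x ↾ S) ◃ antipodeWithFuel k (I ─ S) (x ↾ (I ─ S))
    nonemptyTerm : Subset _ → Carrier
    nonemptyTerm S = if ∣ S ∣ ≡ᵇ 0 then 0# else ⟦ (x ↾ S) ◃ antipode (I ─ S) (x ↾ (I ─ S)) ⟧ w
    F≈nonemptyTerm : ∀ S → S ⊆ I → ⟦ F S ⟧ w ≈ nonemptyTerm S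
    F≈nonemptyTerm S S⊆I with ∣ S ∣ in eqS
    ... | zero  = refl
    ... | suc m = reflexive (≡.cong (λ l → ⟦ (x ↾ S) ◃ l ⟧ w) (antipodeWithFuel≡antipode k (I ─ S) (x ↾ (I ─ S))
                    (ℕ.≤-pred (≡.subst (∣ I ─ S ∣ <_) eq (p⊆q⇒∣q─p∣<∣q∣ S⊆I eqS)))))

  leftSum : Subset n → WSC n → Lin n
  leftSum I x = concatMap (λ S → (x ↾ S) ◃ antipode (I ─ S) (x ↾ (I ─ S))) (subsetsOf I)

  rightSum : Subset n → WSC n → Lin n
  rightSum I x = concatMap (λ S → antipode S (x ↾ S) ▹ (x ↾ (I ─ S))) (subsetsOf I)

  antipode-left : {I : Subset n} {x : WSC n} → IsPF I x → ∀ w → ⟦ leftSum I x ⟧ w ≈ ⟦ ιε I ⟧ w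
  antipode-left {I = I} {x} pf w = begin
    ⟦ leftSum I x ⟧ w                          ≈⟨ ⟦⟧-concatMap _ (subsetsOf I) w ⟩
    ∑⊆ I T                                     ≈⟨ ∑⊆-split-empty I T ⟩
    T ⊥ + ∑[ S ⊆ I ] (if ∣ S ∣ ≡ᵇ 0 then 0# else T S) ≈⟨ +-congʳ T⊥≈ ⟩
    ⟦ antipode I x ⟧ w + ∑[ S ⊆ I ] (if ∣ S ∣ ≡ᵇ 0 then 0# else T S) ≈⟨ antipode-recursion I x w ⟩
    ⟦ ιε I ⟧ w                                 ∎
    where
    T : Subset _ → Carrier
    T S = ⟦ (x ↾ S) ◃ antipode (I ─ S) (x ↾ (I ─ S)) ⟧ w
    T⊥≈ : T ⊥ ≈ ⟦ antipode I x ⟧ w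
    T⊥≈ = begin
      ⟦ (x ↾ ⊥) ◃ s₀ ⟧ w                   ≡⟨ ≡.cong (λ y → ⟦ y ◃ s₀ ⟧ w) (↾-⊥ x) ⟩
      ⟦ [] ◃ s₀ ⟧ w                        ≡⟨ ≡.cong (λ l → ⟦ l ⟧ w) (List.map-id s₀) ⟩
      ⟦ antipode (I ─ ⊥) (x ↾ (I ─ ⊥)) ⟧ w ≡⟨ ≡.cong (λ J → ⟦ antipode J (x ↾ J) ⟧ w) (p─⊥≡p I) ⟩
      ⟦ antipode I (x ↾ I) ⟧ w             ≡⟨ ≡.cong (λ y → ⟦ antipode I y ⟧ w) (pf-↾-self pf) ⟩
      ⟦ antipode I x ⟧ w                   ∎
      where
      s₀ = antipode (I ─ ⊥) (x ↾ (I ─ ⊥))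

  ⊛-ιε : (l : Lin n) (V : Subset n) (w : WSC n) → ⟦ l ⊛ ιε V ⟧ w ≈ (if ∣ V ∣ ≡ᵇ 0 then ⟦ l ⟧ w else 0#)
  ⊛-ιε l V w with ∣ V ∣ ≡ᵇ 0
  ... | true  = ⊛-identityʳ l w
  ... | false = reflexive (≡.cong (λ m → ⟦ m ⟧ w) (⊛-zeroʳ l))

  ιε-⊛ : (V : Subset n) (m : Lin n) (w : WSC n) → ⟦ ιε V ⊛ m ⟧ w ≈ (if ∣ V ∣ ≡ᵇ 0 then ⟦ m ⟧ w else 0#)
  ιε-⊛ V m w with ∣ V ∣ ≡ᵇ 0
  ... | true  = ⊛-identityˡ m w
  ... | false = refl

  ⟦ιε⟧ : (I : Subset n) (x w : WSC n) → ⟦ ιε I ⟧ w ≡ (if ∣ I ∣ ≡ᵇ 0 then ⟦ antipode I x ⟧ w else 0#)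
  ⟦ιε⟧ I x w with ∣ I ∣
  ... | zero  = ≡.refl
  ... | suc _ = ≡.refl

  -- The sum of s_S · x↾T · s_R over all decompositions I = S ⊔ T ⊔ R, computed by first
  -- summing over T ⊔ R (left inverse on I ∖ S) and by first summing over S ⊔ T (right
  -- inverse on I ∖ R, by induction), gives s_I = rightSum I x + [I ≠ ∅] s_I.
  module RightInverse {I : Subset n} {x : WSC n} (pf : IsPF I x)
    (rightSum-smaller : ∀ U → U ⊆ I → ∀ {m} → ∣ U ∣ ≡ suc m →
                        ∀ v → ⟦ rightSum (I ─ U) (x ↾ (I ─ U)) ⟧ v ≈ ⟦ ιε (I ─ U) ⟧ v)
    (w : WSC n) where

    s : Subset n → Lin n
    s S = antipode S (x ↾ S)

    F : Summand₃ n
    F S T R = ⟦ (s S ▹ (x ↾ T)) ⊛ s R ⟧ w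

    left-first : ∑[ S ⊆ I ] ⟦ s S ⊛ leftSum (I ─ S) (x ↾ (I ─ S)) ⟧ w ≈ ⟦ antipode I x ⟧ w
    left-first = begin
      ∑[ S ⊆ I ] ⟦ s S ⊛ leftSum (I ─ S) (x ↾ (I ─ S)) ⟧ w
        ≈⟨ ∑-cong (subsetsOf I) (λ S → ⊛-congʳ (s S) (antipode-left (pf-↾-─ pf S)) w) ⟩
      ∑[ S ⊆ I ] ⟦ s S ⊛ ιε (I ─ S) ⟧ w
        ≈⟨ ∑-cong (subsetsOf I) (λ S → ⊛-ιε (s S) (I ─ S) w) ⟩
      ∑[ S ⊆ I ] (if ∣ I ─ S ∣ ≡ᵇ 0 then ⟦ s S ⟧ w else 0#)
        ≈⟨ ∑⊆-full I (λ S → ⟦ s S ⟧ w) ⟩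
      ⟦ antipode I (x ↾ I) ⟧ w
        ≡⟨ ≡.cong (λ y → ⟦ antipode I y ⟧ w) (pf-↾-self pf) ⟩
      ⟦ antipode I x ⟧ w ∎

    left-first-expanded : ∑[ S ⊆ I ] ⟦ s S ⊛ leftSum (I ─ S) (x ↾ (I ─ S)) ⟧ w ≈ ∑₃ I F
    left-first-expanded = ∑-cong (subsetsOf I) expand
      where
      expand : ∀ S → ⟦ s S ⊛ leftSum (I ─ S) (x ↾ (I ─ S)) ⟧ w ≈ ∑[ T ⊆ I ─ S ] F S T (I ─ S ─ T)
      expand S = trans (⊛-concatMapʳ (s S) _ (subsetsOf V) w) (∑⊆-cong V summand)
        where
        V = I ─ S
        summand : ∀ T → T ⊆ V →
                  ⟦ s S ⊛ ((x ↾ V ↾ T) ◃ antipode (V ─ T) (x ↾ V ↾ (V ─ T))) ⟧ w ≈ F S T (V ─ T)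
        summand T T⊆V = reflexive (≡.trans (≡.cong (λ l → ⟦ l ⟧ w) (⊛-◃ (s S) _ (x ↾ V ↾ T)))
          (≡.cong₂ (λ y z → ⟦ (s S ▹ y) ⊛ antipode (V ─ T) z ⟧ w) (↾-↾-⊆ x T⊆V) (↾-↾-─ x V T)))

    right-last-expanded : ∑[ U ⊆ I ] ⟦ rightSum (I ─ U) (x ↾ (I ─ U)) ⊛ s U ⟧ w ≈ ∑₃ I (rotate F)
    right-last-expanded = ∑-cong (subsetsOf I) expand
      where
      expand : ∀ U → ⟦ rightSum (I ─ U) (x ↾ (I ─ U)) ⊛ s U ⟧ w ≈ ∑[ S ⊆ I ─ U ] F S (I ─ U ─ S) U
      expand U = trans (⊛-concatMapˡ _ (subsetsOf W) (s U) w) (∑⊆-cong W summand)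
        where
        W = I ─ U
        summand : ∀ S → S ⊆ W → ⟦ (antipode S (x ↾ W ↾ S) ▹ (x ↾ W ↾ (W ─ S))) ⊛ s U ⟧ w ≈ F S (W ─ S) U
        summand S S⊆W =
          reflexive (≡.cong₂ (λ y z → ⟦ (antipode S y ▹ z) ⊛ s U ⟧ w) (↾-↾-⊆ x S⊆W) (↾-↾-─ x W S))

    right-last : ∑[ U ⊆ I ] ⟦ rightSum (I ─ U) (x ↾ (I ─ U)) ⊛ s U ⟧ w ≈
                 ⟦ rightSum I x ⟧ w + (if ∣ I ∣ ≡ᵇ 0 then 0# else ⟦ antipode I x ⟧ w)
    right-last = begin
      ∑⊆ I Q
        ≈⟨ ∑⊆-split-empty I Q ⟩
      Q ⊥ + ∑[ U ⊆ I ] (if ∣ U ∣ ≡ᵇ 0 then 0# else Q U)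
        ≈⟨ +-cong Q⊥ (∑⊆-cong I nonempty) ⟩
      ⟦ rightSum I x ⟧ w + ∑[ U ⊆ I ] (if ∣ I ─ U ∣ ≡ᵇ 0 then (if ∣ U ∣ ≡ᵇ 0 then 0# else ⟦ s U ⟧ w) else 0#)
        ≈⟨ +-congˡ (∑⊆-full I (λ U → if ∣ U ∣ ≡ᵇ 0 then 0# else ⟦ s U ⟧ w)) ⟩
      ⟦ rightSum I x ⟧ w + (if ∣ I ∣ ≡ᵇ 0 then 0# else ⟦ antipode I (x ↾ I) ⟧ w)
        ≡⟨ ≡.cong (λ y → ⟦ rightSum I x ⟧ w + (if ∣ I ∣ ≡ᵇ 0 then 0# else ⟦ antipode I y ⟧ w)) (pf-↾-self pf) ⟩
      ⟦ rightSum I x ⟧ w + (if ∣ I ∣ ≡ᵇ 0 then 0# else ⟦ antipode I x ⟧ w) ∎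
      where
      Q : Subset n → Carrier
      Q U = ⟦ rightSum (I ─ U) (x ↾ (I ─ U)) ⊛ s U ⟧ w
      Q⊥ : Q ⊥ ≈ ⟦ rightSum I x ⟧ w
      Q⊥ = begin
        ⟦ rightSum (I ─ ⊥) (x ↾ (I ─ ⊥)) ⊛ s ⊥ ⟧ w
          ≡⟨ ≡.cong (λ J → ⟦ rightSum J (x ↾ J) ⊛ s ⊥ ⟧ w) (p─⊥≡p I) ⟩
        ⟦ rightSum I (x ↾ I) ⊛ s ⊥ ⟧ w
          ≡⟨ ≡.cong₂ (λ y l → ⟦ rightSum I y ⊛ l ⟧ w) (pf-↾-self pf) (antipode-empty ⊥ (x ↾ ⊥) (∣⊥∣≡0 n)) ⟩
        ⟦ rightSum I x ⊛ one ⟧ w                   ≈⟨ ⊛-identityʳ (rightSum I x) w ⟩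
        ⟦ rightSum I x ⟧ w                         ∎
      nonempty : ∀ U → U ⊆ I → (if ∣ U ∣ ≡ᵇ 0 then 0# else Q U) ≈
                 (if ∣ I ─ U ∣ ≡ᵇ 0 then (if ∣ U ∣ ≡ᵇ 0 then 0# else ⟦ s U ⟧ w) else 0#)
      nonempty U U⊆I = by-size ∣ U ∣ ≡.refl
        where
        by-size : ∀ k → ∣ U ∣ ≡ k → (if k ≡ᵇ 0 then 0# else Q U) ≈
                  (if ∣ I ─ U ∣ ≡ᵇ 0 then (if k ≡ᵇ 0 then 0# else ⟦ s U ⟧ w) else 0#)
        by-size zero    _  with ∣ I ─ U ∣ ≡ᵇ 0
        ... | true  = refl
        ... | false = refl
        by-size (suc m) eq = trans
          (⊛-congˡ {l = rightSum (I ─ U) (x ↾ (I ─ U))} {l′ = ιε (I ─ U)} (s U) (rightSum-smaller U U⊆I eq) w)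
          (ιε-⊛ (I ─ U) (s U) w)

    antipode≈rightSum+antipode :
      ⟦ antipode I x ⟧ w ≈ ⟦ rightSum I x ⟧ w + (if ∣ I ∣ ≡ᵇ 0 then 0# else ⟦ antipode I x ⟧ w)
    antipode≈rightSum+antipode = begin
      ⟦ antipode I x ⟧ w                 ≈⟨ left-first ⟨
      ∑[ S ⊆ I ] ⟦ s S ⊛ leftSum (I ─ S) (x ↾ (I ─ S)) ⟧ w ≈⟨ left-first-expanded ⟩
      ∑₃ I F                            ≈⟨ ∑₃-rotate I F ⟩
      ∑₃ I (rotate F)                   ≈⟨ right-last-expanded ⟨
      ∑[ U ⊆ I ] ⟦ rightSum (I ─ U) (x ↾ (I ─ U)) ⊛ s U ⟧ w ≈⟨ right-last ⟩
      ⟦ rightSum I x ⟧ w + (if ∣ I ∣ ≡ᵇ 0 then 0# else ⟦ antipode I x ⟧ w) ∎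

    rightSum≈ιε : ⟦ rightSum I x ⟧ w ≈ ⟦ ιε I ⟧ w
    rightSum≈ιε = trans (cancel (∣ I ∣ ≡ᵇ 0) antipode≈rightSum+antipode) (reflexive (≡.sym (⟦ιε⟧ I x w)))
      where
      cancel : ∀ {a r} β → a ≈ r + (if β then 0# else a) → r ≈ (if β then a else 0#)
      cancel {a} {r} true  a≈r+0 = sym (trans a≈r+0 (+-identityʳ r))
      cancel {a} {r} false a≈r+a = begin
        r             ≈⟨ +-identityʳ r ⟨
        r + 0#        ≈⟨ +-congˡ (-‿inverseʳ a) ⟨
        r + (a - a)   ≈⟨ +-assoc r a (- a) ⟨
        (r + a) - a   ≈⟨ +-congʳ a≈r+a ⟨
        a - a         ≈⟨ -‿inverseʳ a ⟩
        0#            ∎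

  antipode-right : ∀ m {I : Subset n} {x : WSC n} → ∣ I ∣ ≤ m → IsPF I x →
                   ∀ w → ⟦ rightSum I x ⟧ w ≈ ⟦ ιε I ⟧ w
  antipode-right zero    ∣I∣≤0 pf = RightInverse.rightSum≈ιε pf λ U U⊆I eq →
    contradiction (ℕ.≤-trans (p⊆q⇒∣q─p∣<∣q∣ U⊆I eq) ∣I∣≤0) λ ()
  antipode-right (suc m) ∣I∣≤m pf = RightInverse.rightSum≈ιε pf λ U U⊆I eq →
    antipode-right m (ℕ.≤-pred (ℕ.≤-trans (p⊆q⇒∣q─p∣<∣q∣ U⊆I eq) ∣I∣≤m)) (pf-↾-─ pf U)

  antipodeWithFuel-pf : ∀ k {I : Subset n} {x : WSC n} → ∣ I ∣ ≤ k → IsPF I x →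
                        All (IsPF I ∘ proj₂) (antipodeWithFuel k I x)
  antipodeWithFuel-pf zero    {I}     ∣I∣≤0 _  = pf-empty I (ℕ.n≤0⇒n≡0 ∣I∣≤0) ∷ []
  antipodeWithFuel-pf (suc k) {I} {x} ∣I∣≤k pf with ∣ I ∣ ≡ᵇ 0 in eq
  ... | true  = pf-empty I (ℕ.≡ᵇ⇒≡ ∣ I ∣ 0 (≡.subst Bool.T (≡.sym eq) _)) ∷ []
  ... | false = All.map⁺ (All.concat⁺ (All.map⁺ (All.tabulate λ {S} S∈ → summand S (∈-subsetsOf⁻ I S∈))))
    where
    summand : ∀ S → S ⊆ I → All (IsPF I ∘ proj₂)
      (if ∣ S ∣ ≡ᵇ 0 then [] else (x ↾ S) ◃ antipodeWithFuel k (I ─ S) (x ↾ (I ─ S)))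
    summand S S⊆I with ∣ S ∣ in eqS
    ... | zero  = []
    ... | suc _ = All.map⁺ (All.map (pf-↾-++ pf S⊆I)
      (antipodeWithFuel-pf k (ℕ.≤-pred (ℕ.≤-trans (p⊆q⇒∣q─p∣<∣q∣ S⊆I eqS) ∣I∣≤k)) (pf-↾-─ pf S)))

  antipode-support : {I : Subset n} {x : WSC n} (w : WSC n) → IsPF I x → ¬ ⟦ antipode I x ⟧ w ≈ 0# → IsPF I w
  antipode-support {I = I} {x} w pf = ⟦⟧-support (IsPF I) (antipode I x) (antipodeWithFuel-pf ∣ I ∣ ℕ.≤-refl pf)


module ListPermutation where

  open import Data.List using (List; []; _∷_; concatMap)
  open import Data.List.Relation.Binary.Permutation.Propositional using (_↭_; ↭-refl; ↭-trans; refl; prep; swap; trans)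
  open import Data.List.Relation.Binary.Permutation.Propositional.Properties using (++⁺ˡ; ++⁺; shifts)

  concatMap⁺ : ∀ {a b} {A : Set a} {B : Set b} (f : A → List B) {xs ys : List A} →
               xs ↭ ys → concatMap f xs ↭ concatMap f ys
  concatMap⁺ f refl         = ↭-refl
  concatMap⁺ f (prep x p)   = ++⁺ˡ (f x) (concatMap⁺ f p)
  concatMap⁺ f (swap x y p) = ↭-trans (shifts (f x) (f y)) (++⁺ˡ (f y) (++⁺ˡ (f x) (concatMap⁺ f p)))
  concatMap⁺ f (trans p q)  = ↭-trans (concatMap⁺ f p) (concatMap⁺ f q)

  concatMap-↭ : ∀ {a b} {A : Set a} {B : Set b} {f g : A → List B} (xs : List A) →
                (∀ x → f x ↭ g x) → concatMap f xs ↭ concatMap g xs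
  concatMap-↭ []       f↭g = ↭-refl
  concatMap-↭ (x ∷ xs) f↭g = ++⁺ (f↭g x) (concatMap-↭ xs f↭g)


module AntipodeNaturality {c ℓ} (K : Field c ℓ) where

  open import Data.Nat using (ℕ; zero; suc; _≡ᵇ_)
  open import Data.Bool using (true; false; if_then_else_)
  open import Data.Fin.Subset using (Subset; _─_; ∣_∣)
  open import Data.Fin.Permutation using (Permutation′)
  open import Data.List using ([]; map; concatMap)
  import Data.List.Properties as List
  open import Data.List.Relation.Binary.Permutation.Propositional using (_↭_; ↭-refl; module PermutationReasoning)
  open import Data.List.Relation.Binary.Permutation.Propositional.Properties using (map⁺)
  open import Data.Product using (_,_; proj₁; proj₂; map₂)
  open import Function using (_∘_)
  import Relation.Binary.PropositionalEquality as ≡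
  open ≡ using (_≡_)
  open ParkingFunctions
  open Relabelling
  open ListPermutation

  open Field K using (_≈_; trans)
  open Coefficients K
  open ConcatenationProduct K
  open Antipode K
  open PermutationReasoning

  private variable
    n : ℕ

  relabel : Permutation′ n → Lin n → Lin n
  relabel σ = map (map₂ (actW σ))

  relabel-neg : (σ : Permutation′ n) (l : Lin n) → relabel σ (neg l) ≡ neg (relabel σ l)
  relabel-neg σ l = ≡.trans (≡.sym (List.map-∘ l)) (List.map-∘ l)

  relabel-◃ : (σ : Permutation′ n) (y : WSC n) (l : Lin n) → actW σ y ◃ relabel σ l ≡ relabel σ (y ◃ l)
  relabel-◃ σ y l = ≡.trans (≡.sym (List.map-∘ l))
    (≡.trans (List.map-cong (λ t → ≡.cong (proj₁ t ,_) (≡.sym (List.map-++ (actS σ) y (proj₂ t)))) l) (List.map-∘ l))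

  antipodeWithFuel-actS : ∀ k (σ : Permutation′ n) (I : Subset n) (x : WSC n) →
    antipodeWithFuel k (actS σ I) (actW σ x) ↭ relabel σ (antipodeWithFuel k I x)
  antipodeWithFuel-actS zero    σ I x = ↭-refl
  antipodeWithFuel-actS (suc k) σ I x rewrite ∣actS∣ σ I with ∣ I ∣ ≡ᵇ 0
  ... | true  = ↭-refl
  ... | false = begin
    neg (concatMap F′ (subsetsOf (actS σ I)))                 ↭⟨ map⁺ _ (concatMap⁺ F′ (subsetsOf-actS σ I)) ⟩
    neg (concatMap F′ (map (actS σ) (subsetsOf I)))           ≡⟨ ≡.cong neg (List.concatMap-map F′ (actS σ) (subsetsOf I)) ⟩
    neg (concatMap (F′ ∘ actS σ) (subsetsOf I))               ↭⟨ map⁺ _ (concatMap-↭ (subsetsOf I) summand) ⟩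
    neg (concatMap (relabel σ ∘ F) (subsetsOf I))
      ≡⟨ ≡.cong neg (List.map-concatMap (map₂ (actW σ)) F (subsetsOf I)) ⟨
    neg (relabel σ (concatMap F (subsetsOf I)))               ≡⟨ relabel-neg σ (concatMap F (subsetsOf I)) ⟨
    relabel σ (neg (concatMap F (subsetsOf I)))               ∎
    where
    F′ F : Subset _ → Lin _
    F′ S = if ∣ S ∣ ≡ᵇ 0 then [] else (actW σ x ↾ S) ◃ antipodeWithFuel k (actS σ I ─ S) (actW σ x ↾ (actS σ I ─ S))
    F  S = if ∣ S ∣ ≡ᵇ 0 then [] else (x ↾ S) ◃ antipodeWithFuel k (I ─ S) (x ↾ (I ─ S))
    summand : ∀ S → F′ (actS σ S) ↭ relabel σ (F S)
    summand S rewrite ∣actS∣ σ S with ∣ S ∣ ≡ᵇ 0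
    ... | true  = ↭-refl
    ... | false = begin
      (actW σ x ↾ actS σ S) ◃ antipodeWithFuel k (actS σ I ─ actS σ S) (actW σ x ↾ (actS σ I ─ actS σ S))
        ≡⟨ ≡.cong (λ J → (actW σ x ↾ actS σ S) ◃ antipodeWithFuel k J (actW σ x ↾ J)) (actS-─ σ I S) ⟨
      (actW σ x ↾ actS σ S) ◃ antipodeWithFuel k (actS σ (I ─ S)) (actW σ x ↾ actS σ (I ─ S))
        ≡⟨ ≡.cong₂ (λ y z → y ◃ antipodeWithFuel k (actS σ (I ─ S)) z) (actW-↾ σ x S) (actW-↾ σ x (I ─ S)) ⟩
      actW σ (x ↾ S) ◃ antipodeWithFuel k (actS σ (I ─ S)) (actW σ (x ↾ (I ─ S)))
        ↭⟨ map⁺ _ (antipodeWithFuel-actS k σ (I ─ S) (x ↾ (I ─ S))) ⟩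
      actW σ (x ↾ S) ◃ relabel σ (antipodeWithFuel k (I ─ S) (x ↾ (I ─ S)))
        ≡⟨ relabel-◃ σ (x ↾ S) _ ⟩
      relabel σ ((x ↾ S) ◃ antipodeWithFuel k (I ─ S) (x ↾ (I ─ S))) ∎

  antipode-actS : (σ : Permutation′ n) (I : Subset n) (x w : WSC n) →
                  ⟦ antipode (actS σ I) (actW σ x) ⟧ (actW σ w) ≈ ⟦ antipode I x ⟧ w
  antipode-actS σ I x w rewrite ∣actS∣ σ I =
    trans (⟦⟧-↭ (antipodeWithFuel-actS ∣ I ∣ σ I x) (actW σ w))
      (⟦⟧-map-injective (actW σ) (actW-injective σ) (antipode I x) w)


open import Data.Fin.Subset using (⊥)
open import Data.Fin.Subset.Properties using (∣⊥∣≡0)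
open import Data.List.Properties using (map-++; ++-assoc; ++-identityʳ)
import Data.Nat.Properties as ℕ
open import Relation.Binary.PropositionalEquality using (refl; cong₂)
open import Data.Product using (_,_)
open ParkingFunctions
open Relabelling

-- Characteristic 0 is not needed: the antipode is defined over any field.
theorem4p7 : ∀ {c ℓ} (K : Field c ℓ) → CharZero K →
    IsHopfMonoid K _≟W_ IsPF actW μPF ΔPF []
theorem4p7 K _ = record
  { act-X     = pf-actW
  ; act-id    = actW-id
  ; act-∘     = actW-∘
  ; μ-X       = pf-++
  ; Δ-X       = λ _ → pf-Δ
  ; μ-nat     = λ σ {_} {_} {x} {y} _ _ _ → map-++ (actS σ) x y
  ; Δ-nat     = λ σ {S} {T} {x} _ _ → cong₂ _,_ (actW-↾ σ x S) (actW-↾ σ x T)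
  ; e-X       = λ {n} → pf-empty ⊥ (∣⊥∣≡0 n)
  ; μ-assoc   = λ {_} {_} {_} {_} {x} {y} {z} _ _ _ _ _ _ → ++-assoc x y z
  ; μ-unitˡ   = λ _ → refl
  ; μ-unitʳ   = λ {_} {_} {x} _ → ++-identityʳ x
  ; Δ-coassoc = λ {_} {R} {S} {T} {x} _ _ _ _ → ↾-coassoc x R S T
  ; Δ-counitˡ = λ {_} {_} {x} pf → cong₂ _,_ (↾-⊥ x) (pf-↾-self pf)
  ; Δ-counitʳ = λ {_} {_} {x} pf → cong₂ _,_ (pf-↾-self pf) (↾-⊥ x)
  ; compat    = λ {_} {_} {_} {S′} {T′} _ _ _ pfx pfy → cong₂ _,_ (++-↾ pfx pfy S′) (++-↾ pfx pfy T′)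
  ; s         = antipode
  ; s-X       = antipode-support
  ; s-nat     = λ σ {I} {x} w _ → antipode-actS σ I x w
  ; s-left    = antipode-left
  ; s-right   = antipode-right _ ℕ.≤-refl
  }
  where
  open Antipode K
  open AntipodeNaturality K
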